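{- Let $0<\varepsilon\le1$. Then the region algorithm completes at least half of all jobs it admits before their deadlines.
   Context: Problem: $m$ unrelated machines; jobs arrive online at release dates $r_j$, each with deadline $d_j$ and processing times $p_{ij}\in\mathbb{R}_+\cup\{\infty\}$, revealed at $r_j$; preemption allowed, no migration; a job processed on machine $i$ completes on time if it receives $p_{ij}$ units on $i$ within $[r_j,d_j)$. Slack assumption: $d_j-r_j\ge(1+\varepsilon)p_{ij}$ for every $i$ with $p_{ij}<\infty$. Region algorithm: once a job is admitted to a machine it is processed only there. A job $j$ is available for machine $i$ at time $\tau$ if $r_j\le\tau$, $j$ has not been admitted, and $d_j-\tau\ge(1+\frac{\varepsilon}{2})p_{ij}$. Scheduling rule: at every time, each machine processes the admitted, not yet completed job on it with smallest processing time (jobs may be processed after their deadlines). Whenever a job is released or completed at time $\tau$: for $i=1,\dots,m$ in order, let $j^\star$ be a shortest job available for machine $i$ and $j$ the job currently processed on $i$; if $i$ processes no job, or if $p_{ij^\star}<\frac{\varepsilon}{4}p_{ij}$, admit $j^\star$ to machine $i$ at time $\tau$ and restart the routine; otherwise proceed to machine $i+1$. -}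

module Defs where

open import Level using (0ℓ)
open import Data.Nat using (ℕ; zero; suc) renaming (_+_ to _+ℕ_; _<_ to _<ℕ_)
open import Data.Fin using (Fin; toℕ) renaming (zero to fz; suc to fs)
open import Data.Maybe using (Maybe; just; nothing)
open import Data.Bool using (Bool; true; false; if_then_else_)
open import Data.Product using (Σ; ∃; ∃-syntax; _×_; _,_)
open import Data.Sum using (_⊎_)
open import Relation.Nullary using (¬_; does)
open import Relation.Binary.PropositionalEquality using (_≡_; _≢_)
open import Relation.Binary.Definitions using (Decidable)
open import Relation.Binary.Structures using (IsTotalOrder)
open import Algebra.Structures using (IsCommutativeRing)

-- The real numbers, axiomatised as a complete ordered field (with
-- propositional equality).  Every model of this record is (isomorphic
-- to) ℝ; the statement is quantified over all models.

record RealField : Set₁ where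
  infixl 6 _+_
  infixl 7 _*_
  infix  4 _≤_
  field
    R          : Set
    _+_ _*_    : R → R → R
    -_         : R → R
    0# 1#      : R
    isCommutativeRing : IsCommutativeRing _≡_ _+_ _*_ -_ 0# 1#
    0≢1        : 0# ≢ 1#
    inverse    : ∀ x → x ≢ 0# → Σ R (λ y → x * y ≡ 1#)
    _≤_        : R → R → Set
    isTotalOrder : IsTotalOrder _≡_ _≤_
    _≤?_       : Decidable _≤_
    +-mono-≤   : ∀ {x y} z → x ≤ y → x + z ≤ y + z
    *-nonneg   : ∀ {x y} → 0# ≤ x → 0# ≤ y → 0# ≤ x * y
    sup        : (S : R → Set) → (∃ λ x → S x) → (∃ λ b → ∀ x → S x → x ≤ b) →
                 ∃ λ s → (∀ x → S x → x ≤ s) × (∀ b → (∀ x → S x → x ≤ b) → s ≤ b)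

  infix 4 _<_
  _<_ : R → R → Set
  x < y = x ≤ y × x ≢ y

  infixl 6 _−_
  _−_ : R → R → R
  x − y = x + (- y)

  2# 4# : R
  2# = 1# + 1#
  4# = 2# + 2#

count : ∀ {n} → (Fin n → Bool) → ℕ
count {zero}  f = 0
count {suc n} f = (if f fz then 1 else 0) +ℕ count (λ k → f (fs k))

module _ (F : RealField) where
  open RealField F

  -- An instance: m unrelated machines, n jobs; p i j = nothing means ∞.
  record Instance (m n : ℕ) : Set where
    field
      r d : Fin n → R
      p   : Fin m → Fin n → Maybe R
      p-nonneg : ∀ i j x → p i j ≡ just x → 0# ≤ x

  Slack : ∀ {m n} → Instance m n → R → Set
  Slack I ε = ∀ i j x → Instance.p I i j ≡ just x → (1# + ε) * x ≤ Instance.d I j − Instance.r I j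

  -- Status of a job: not (yet) admitted; admitted to machine i and not
  -- completed, with remaining processing requirement rem; or completed
  -- on machine i at time t.
  data Status (m : ℕ) : Set where
    pending : Status m
    active  : Fin m → R → Status m
    done    : Fin m → R → Status m

  State : ℕ → ℕ → Set
  State m n = R × (Fin n → Status m)

  module Region {m n : ℕ} (I : Instance m n) (ε : R) where
    open Instance I

    -- job j (with processing time x on machine i) is available for machine i
    -- at the state: released, not admitted, and d_j - τ ≥ (1 + ε/2) p_ij,
    -- written without division as (2 + ε) p_ij ≤ 2 (d_j - τ).
    Available : State m n → Fin m → Fin n → R → Set
    Available (τ , σ) i j x =
      σ j ≡ pending × r j ≤ τ × p i j ≡ just x × (2# + ε) * x ≤ 2# * (d j − τ)

    ActiveOn : State m n → Fin m → Fin n → Set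
    ActiveOn (τ , σ) i j = ∃ λ rem → σ j ≡ active i rem

    Idle : State m n → Fin m → Set
    Idle s i = ∀ j → ¬ ActiveOn s i j

    Current : State m n → Fin m → Fin n → R → Set
    Current s i c y =
      ActiveOn s i c × p i c ≡ just y ×
      (∀ k y' → ActiveOn s i k → p i k ≡ just y' → y ≤ y')

    ShortestAvailable : State m n → Fin m → Fin n → R → Set
    ShortestAvailable s i j x =
      Available s i j x × (∀ k x' → Available s i k x' → x ≤ x')

    -- the admission test of the routine succeeds for machine i and job j:
    -- j shortest available, and i idle or p_ij < (ε/4) p_ic for the job c
    -- currently processed on i (written as 4 p_ij < ε p_ic).
    Admits : State m n → Fin m → Fin n → Set
    Admits s i j = ∃ λ x → ShortestAvailable s i j x ×
      (Idle s i ⊎ ∃ λ c → ∃ λ y → Current s i c y × 4# * x < ε * y)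

    Wants : State m n → Fin m → Set
    Wants s i = ∃ λ j → Admits s i j

    data AdmittedStatus (i : Fin m) (τ x : R) : Status m → Set where
      adm-zero : x ≡ 0# → AdmittedStatus i τ x (done i τ)
      adm-pos  : x ≢ 0# → AdmittedStatus i τ x (active i x)

    -- Since an admission only
    -- removes j from the available jobs and only changes the processed job
    -- of machine i, "restart the routine" amounts to: admit at the first
    -- machine (in order 1..m) whose test succeeds.
    data AdmitStep : State m n → State m n → Set where
      admit : ∀ {τ σ σ'} i j x →
        Admits (τ , σ) i j →
        (∀ k → toℕ k <ℕ toℕ i → ¬ Wants (τ , σ) k) →
        p i j ≡ just x →
        AdmittedStatus i τ x (σ' j) →
        (∀ k → k ≢ j → σ' k ≡ σ k) →
        AdmitStep (τ , σ) (τ , σ')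

    Quiet : State m n → Set
    Quiet s = ∀ i → ¬ Wants s i

    Processing : State m n → (Fin m → Maybe (Fin n)) → Set
    Processing s proc = ∀ i →
      (proc i ≡ nothing × Idle s i) ⊎
      (∃ λ c → proc i ≡ just c × ∃ λ y → Current s i c y)

    data Evolve (τ τ' : R) (proc : Fin m → Maybe (Fin n)) (k : Fin n) :
                Status m → Status m → Set where
      ev-pending : Evolve τ τ' proc k pending pending
      ev-done    : ∀ i t → Evolve τ τ' proc k (done i t) (done i t)
      ev-wait    : ∀ i rem → proc i ≢ just k →
                   Evolve τ τ' proc k (active i rem) (active i rem)
      ev-finish  : ∀ i rem → proc i ≡ just k → τ + rem ≡ τ' →
                   Evolve τ τ' proc k (active i rem) (done i τ')
      ev-run     : ∀ i rem → proc i ≡ just k → τ + rem ≢ τ' →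
                   Evolve τ τ' proc k (active i rem) (active i (rem − (τ' − τ)))

    IsNextEvent : State m n → (Fin m → Maybe (Fin n)) → R → Set
    IsNextEvent (τ , σ) proc τ' =
      τ < τ' ×
      (∀ j → τ < r j → τ' ≤ r j) ×
      (∀ i c rem → proc i ≡ just c → σ c ≡ active i rem → τ' ≤ τ + rem) ×
      ((∃ λ j → τ < r j × τ' ≡ r j) ⊎
       (∃ λ i → ∃ λ c → ∃ λ rem → proc i ≡ just c × σ c ≡ active i rem × τ' ≡ τ + rem))

    data AdvanceStep : State m n → State m n → Set where
      advance : ∀ {τ σ τ' σ'} proc →
        Quiet (τ , σ) →
        Processing (τ , σ) proc →
        IsNextEvent (τ , σ) proc τ' →
        (∀ k → Evolve τ τ' proc k (σ k) (σ' k)) →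
        AdvanceStep (τ , σ) (τ' , σ')

    Step : State m n → State m n → Set
    Step s s' = AdmitStep s s' ⊎ AdvanceStep s s'

    initial : R → State m n
    initial τ₀ = τ₀ , λ _ → pending

    Final : State m n → Set
    Final (τ , σ) = Quiet (τ , σ) × (∀ i → Idle (τ , σ) i) × (∀ j → ¬ (τ < r j))

    isAdmitted : Status m → Bool
    isAdmitted pending = false
    isAdmitted (active _ _) = true
    isAdmitted (done _ _) = true

    onTime : Fin n → Status m → Bool
    onTime j (done _ t) = does (t ≤? d j)
    onTime j _ = false

    #admitted : State m n → ℕ
    #admitted (τ , σ) = count (λ j → isAdmitted (σ j))

    #onTime : State m n → ℕ
    #onTime (τ , σ) = count (λ j → onTime j (σ j))

module Submission where

-- Charging argument.  A job admitted to a busy machine preempts the job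
-- processed there, which becomes its parent, so the admitted jobs form a
-- forest.  Give every completed job the surplus 2·(on-time) − (admitted) of
-- its subtree.  A job completing on time has surplus one more than the sum
-- over its children.  A late job was admitted with slack (1 + ε/2) p, so it
-- waited at least ε p / 2 behind its children; as each child is smaller
-- than ε/4 of its parent, their surpluses add up to at least 2 and the late
-- job still has surplus ≥ 1.  The invariant that drives this is that the
-- surplus exceeds m once the subtree volume exceeds 2^m times the job's
-- size.  Summing over all completed jobs, #admitted ≤ 2 · #onTime.

open import Defs
open import Data.Nat using (ℕ) renaming (_≤_ to _≤ℕ_; _*_ to _*ℕ_)
open import Data.Product using (_×_)
open import Relation.Binary.Construct.Closure.ReflexiveTransitive using (Star)

open import Level using (0ℓ)
open import Algebra using (CommutativeRing; CommutativeMonoid; RawRing)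
import Algebra.Solver.Ring.AlmostCommutativeRing as ACR
open import Data.Bool using (Bool; true; false; if_then_else_)
open import Data.Empty using (⊥; ⊥-elim)
open import Data.Fin as Fin using (Fin) renaming (zero to fz; suc to fs)
import Data.Fin.Properties as FinP
open import Data.Integer as ℤ using (ℤ; -[1+_]; sign; ∣_∣; _◃_)
import Data.Integer.Properties as ℤP
open import Data.Maybe using (Maybe; just; nothing)
import Data.Maybe.Properties as MaybeP
open import Data.Nat as ℕ using (zero; suc)
import Data.Nat.Properties as ℕP
open import Data.Product using (Σ; ∃; _,_; proj₁; proj₂)
open import Data.Sign as Sign using (Sign)
open import Data.Sum using (_⊎_; inj₁; inj₂)
open import Data.Vec.Functional using (Vector)
open import Relation.Binary.Construct.Closure.ReflexiveTransitive using (_◅_) renaming (ε to [])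
open import Relation.Binary.PropositionalEquality
open import Relation.Binary.Structures using (IsTotalOrder)
open import Relation.Nullary using (¬_; yes; no; does; Dec)

-- The ring solver needs computable coefficients, so we map ℤ into R along
-- the canonical ring homomorphism.
module IntegerCoefficients (F : RealField) where
  open RealField F

  commutativeRing : CommutativeRing 0ℓ 0ℓ
  commutativeRing = record { isCommutativeRing = isCommutativeRing }

  open CommutativeRing commutativeRing using
    (+-assoc; +-comm; +-identityˡ; +-identityʳ; -‿inverseʳ;
     *-identityˡ; *-identityʳ; distribʳ; zeroˡ; zeroʳ; +-abelianGroup; +-group; ring)
  open import Algebra.Properties.AbelianGroup +-abelianGroup using (⁻¹-∙-comm)
  open import Algebra.Properties.Group +-group using (⁻¹-involutive; ε⁻¹≈ε)
  open import Algebra.Properties.Ring ring using (-1*x≈-x)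
  open import Algebra.Properties.CommutativeSemigroup
    (CommutativeRing.*-commutativeSemigroup commutativeRing) using (interchange)
  open ≡-Reasoning

  -- fromℕ 1 reduces to 1#, which makes the 1-homomorphism law hold by refl.
  fromℕ : ℕ → R
  fromℕ zero = 0#
  fromℕ (suc zero) = 1#
  fromℕ (suc (suc n)) = 1# + fromℕ (suc n)

  fromℕ-suc : ∀ n → fromℕ (suc n) ≡ 1# + fromℕ n
  fromℕ-suc zero = sym (+-identityʳ 1#)
  fromℕ-suc (suc n) = refl

  fromℕ-+ : ∀ m n → fromℕ (m ℕ.+ n) ≡ fromℕ m + fromℕ n
  fromℕ-+ zero n = sym (+-identityˡ (fromℕ n))
  fromℕ-+ (suc m) n = begin
    fromℕ (suc (m ℕ.+ n))         ≡⟨ fromℕ-suc (m ℕ.+ n) ⟩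
    1# + fromℕ (m ℕ.+ n)          ≡⟨ cong (1# +_) (fromℕ-+ m n) ⟩
    1# + (fromℕ m + fromℕ n)      ≡⟨ sym (+-assoc 1# (fromℕ m) (fromℕ n)) ⟩
    (1# + fromℕ m) + fromℕ n      ≡⟨ cong (_+ fromℕ n) (sym (fromℕ-suc m)) ⟩
    fromℕ (suc m) + fromℕ n       ∎

  fromℕ-* : ∀ m n → fromℕ (m ℕ.* n) ≡ fromℕ m * fromℕ n
  fromℕ-* zero n = sym (zeroˡ (fromℕ n))
  fromℕ-* (suc m) n = begin
    fromℕ (n ℕ.+ m ℕ.* n)             ≡⟨ fromℕ-+ n (m ℕ.* n) ⟩
    fromℕ n + fromℕ (m ℕ.* n)         ≡⟨ cong (fromℕ n +_) (fromℕ-* m n) ⟩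
    fromℕ n + fromℕ m * fromℕ n       ≡⟨ cong (_+ fromℕ m * fromℕ n) (sym (*-identityˡ (fromℕ n))) ⟩
    1# * fromℕ n + fromℕ m * fromℕ n  ≡⟨ sym (distribʳ (fromℕ n) 1# (fromℕ m)) ⟩
    (1# + fromℕ m) * fromℕ n          ≡⟨ cong (_* fromℕ n) (sym (fromℕ-suc m)) ⟩
    fromℕ (suc m) * fromℕ n           ∎

  fromℤ : ℤ → R
  fromℤ (ℤ.+ n) = fromℕ n
  fromℤ -[1+ n ] = - fromℕ (suc n)

  fromℤ-neg : ∀ z → fromℤ (ℤ.- z) ≡ - fromℤ z
  fromℤ-neg -[1+ n ] = sym (⁻¹-involutive (fromℕ (suc n)))
  fromℤ-neg (ℤ.+ zero) = sym ε⁻¹≈ε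
  fromℤ-neg (ℤ.+ suc n) = refl

  fromℤ-⊖ : ∀ m n → fromℤ (m ℤ.⊖ n) ≡ fromℕ m + (- fromℕ n)
  fromℤ-⊖ m zero = trans (sym (+-identityʳ (fromℕ m))) (cong (fromℕ m +_) (sym ε⁻¹≈ε))
  fromℤ-⊖ zero (suc n) = sym (+-identityˡ _)
  fromℤ-⊖ (suc m) (suc n) = begin
    fromℤ (suc m ℤ.⊖ suc n)                      ≡⟨ cong fromℤ (ℤP.[1+m]⊖[1+n]≡m⊖n m n) ⟩
    fromℤ (m ℤ.⊖ n)                              ≡⟨ fromℤ-⊖ m n ⟩
    fromℕ m + (- fromℕ n)                        ≡⟨ sym (cancel-1 (fromℕ m) (fromℕ n)) ⟩
    (1# + fromℕ m) + (- (1# + fromℕ n))          ≡⟨ cong₂ (λ a b → a + (- b)) (sym (fromℕ-suc m)) (sym (fromℕ-suc n)) ⟩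
    fromℕ (suc m) + (- fromℕ (suc n))            ∎
    where
    cancel-1 : ∀ a b → (1# + a) + (- (1# + b)) ≡ a + (- b)
    cancel-1 a b = begin
      (1# + a) + (- (1# + b))        ≡⟨ cong ((1# + a) +_) (sym (⁻¹-∙-comm 1# b)) ⟩
      (1# + a) + ((- 1#) + (- b))    ≡⟨ cong (_+ ((- 1#) + (- b))) (+-comm 1# a) ⟩
      (a + 1#) + ((- 1#) + (- b))    ≡⟨ +-assoc a 1# _ ⟩
      a + (1# + ((- 1#) + (- b)))    ≡⟨ cong (a +_) (sym (+-assoc 1# (- 1#) (- b))) ⟩
      a + ((1# + (- 1#)) + (- b))    ≡⟨ cong (λ t → a + (t + (- b))) (-‿inverseʳ 1#) ⟩
      a + (0# + (- b))               ≡⟨ cong (a +_) (+-identityˡ (- b)) ⟩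
      a + (- b)                      ∎

  fromℤ-+ : ∀ i j → fromℤ (i ℤ.+ j) ≡ fromℤ i + fromℤ j
  fromℤ-+ -[1+ m ] -[1+ n ] = begin
    - fromℕ (suc (suc (m ℕ.+ n)))          ≡⟨ cong (λ k → - fromℕ (suc k)) (sym (ℕP.+-suc m n)) ⟩
    - fromℕ (suc m ℕ.+ suc n)              ≡⟨ cong -_ (fromℕ-+ (suc m) (suc n)) ⟩
    - (fromℕ (suc m) + fromℕ (suc n))      ≡⟨ sym (⁻¹-∙-comm _ _) ⟩
    (- fromℕ (suc m)) + (- fromℕ (suc n))  ∎
  fromℤ-+ -[1+ m ] (ℤ.+ n) = trans (fromℤ-⊖ n (suc m)) (+-comm _ _)
  fromℤ-+ (ℤ.+ m) -[1+ n ] = fromℤ-⊖ m (suc n)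
  fromℤ-+ (ℤ.+ m) (ℤ.+ n) = fromℕ-+ m n

  fromSign : Sign → R
  fromSign Sign.+ = 1#
  fromSign Sign.- = - 1#

  fromSign-* : ∀ s t → fromSign (s Sign.* t) ≡ fromSign s * fromSign t
  fromSign-* Sign.+ t = sym (*-identityˡ _)
  fromSign-* Sign.- Sign.+ = sym (*-identityʳ _)
  fromSign-* Sign.- Sign.- = trans (sym (⁻¹-involutive 1#)) (sym (-1*x≈-x (- 1#)))

  fromℤ-◃ : ∀ s k → fromℤ (s ◃ k) ≡ fromSign s * fromℕ k
  fromℤ-◃ s zero = sym (zeroʳ (fromSign s))
  fromℤ-◃ Sign.+ (suc k) = sym (*-identityˡ _)
  fromℤ-◃ Sign.- (suc k) = sym (-1*x≈-x _)

  fromℤ-sign-abs : ∀ i → fromℤ i ≡ fromSign (sign i) * fromℕ ∣ i ∣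
  fromℤ-sign-abs (ℤ.+ n) = sym (*-identityˡ _)
  fromℤ-sign-abs -[1+ n ] = sym (-1*x≈-x _)

  fromℤ-* : ∀ i j → fromℤ (i ℤ.* j) ≡ fromℤ i * fromℤ j
  fromℤ-* i j = begin
    fromℤ ((sign i Sign.* sign j) ◃ (∣ i ∣ ℕ.* ∣ j ∣))
      ≡⟨ fromℤ-◃ (sign i Sign.* sign j) (∣ i ∣ ℕ.* ∣ j ∣) ⟩
    fromSign (sign i Sign.* sign j) * fromℕ (∣ i ∣ ℕ.* ∣ j ∣)
      ≡⟨ cong₂ _*_ (fromSign-* (sign i) (sign j)) (fromℕ-* ∣ i ∣ ∣ j ∣) ⟩
    (fromSign (sign i) * fromSign (sign j)) * (fromℕ ∣ i ∣ * fromℕ ∣ j ∣)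
      ≡⟨ interchange _ _ _ _ ⟩
    (fromSign (sign i) * fromℕ ∣ i ∣) * (fromSign (sign j) * fromℕ ∣ j ∣)
      ≡⟨ sym (cong₂ _*_ (fromℤ-sign-abs i) (fromℤ-sign-abs j)) ⟩
    fromℤ i * fromℤ j ∎

  ℤ-rawRing : RawRing 0ℓ 0ℓ
  ℤ-rawRing = record
    { Carrier = ℤ ; _≈_ = _≡_ ; _+_ = ℤ._+_ ; _*_ = ℤ._*_ ; -_ = ℤ.-_ ; 0# = ℤ.+ 0 ; 1# = ℤ.+ 1 }

  fromℤ-morphism : ℤ-rawRing ACR.-Raw-AlmostCommutative⟶ ACR.fromCommutativeRing commutativeRing
  fromℤ-morphism = record
    { ⟦_⟧ = fromℤ ; +-homo = fromℤ-+ ; *-homo = fromℤ-* ; -‿homo = fromℤ-neg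
    ; 0-homo = refl ; 1-homo = refl }

  fromℤ-≟ : ∀ a b → Maybe (fromℤ a ≡ fromℤ b)
  fromℤ-≟ a b with a ℤ.≟ b
  ... | yes a≡b = just (cong fromℤ a≡b)
  ... | no _ = nothing

  open import Algebra.Solver.Ring ℤ-rawRing (ACR.fromCommutativeRing commutativeRing)
    fromℤ-morphism fromℤ-≟ public using (solve; _:=_; _:+_; _:*_; :-_; _:-_; con; Polynomial)

  -- Numerals of RealField are sums of 1#, hence 4# is written 2 + 2, not con 4.
  :2 :4 : ∀ {n} → Polynomial n
  :2 = con (ℤ.+ 2)
  :4 = :2 :+ :2

module OrderedField (F : RealField) where
  open RealField F public
  open IntegerCoefficients F public
  open CommutativeRing commutativeRing public using
    (+-assoc; +-comm; +-identityˡ; +-identityʳ; -‿inverseʳ; *-comm;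
     *-identityˡ; distribʳ; zeroˡ; zeroʳ; +-commutativeMonoid)
  open IsTotalOrder isTotalOrder public using ()
    renaming (trans to ≤-trans; antisym to ≤-antisym; total to ≤-total; reflexive to ≤-reflexive)

  ≤-refl : ∀ {a} → a ≤ a
  ≤-refl = ≤-reflexive refl

  -- The classical strict order; unlike _<_ it composes with _≤_ without
  -- inspecting equalities.
  infix 4 _≺_
  _≺_ : R → R → Set
  a ≺ b = ¬ (b ≤ a)

  ≺⇒≤ : ∀ {a b} → a ≺ b → a ≤ b
  ≺⇒≤ {a} {b} a≺b with ≤-total a b
  ... | inj₁ a≤b = a≤b
  ... | inj₂ b≤a = ⊥-elim (a≺b b≤a)

  <⇒≺ : ∀ {a b} → a < b → a ≺ b
  <⇒≺ (a≤b , a≢b) b≤a = a≢b (≤-antisym a≤b b≤a)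

  ≤∧≢⇒≺ : ∀ {a b} → a ≤ b → a ≢ b → a ≺ b
  ≤∧≢⇒≺ a≤b a≢b b≤a = a≢b (≤-antisym a≤b b≤a)

  ≺-irrefl : ∀ {a} → ¬ (a ≺ a)
  ≺-irrefl a≺a = a≺a ≤-refl

  ≤-≺-trans : ∀ {a b c} → a ≤ b → b ≺ c → a ≺ c
  ≤-≺-trans a≤b b≺c c≤a = b≺c (≤-trans c≤a a≤b)

  ≺-≤-trans : ∀ {a b c} → a ≺ b → b ≤ c → a ≺ c
  ≺-≤-trans a≺b b≤c c≤a = a≺b (≤-trans b≤c c≤a)

  ≺-or-≥ : ∀ a b → a ≺ b ⊎ b ≤ a
  ≺-or-≥ a b with b ≤? a
  ... | yes b≤a = inj₂ b≤a
  ... | no b≰a = inj₁ b≰a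

  +-monoʳ-≤ : ∀ {a b} c → a ≤ b → c + a ≤ c + b
  +-monoʳ-≤ {a} {b} c a≤b = subst₂ _≤_ (+-comm a c) (+-comm b c) (+-mono-≤ c a≤b)

  +-mono-≤₂ : ∀ {a b c d} → a ≤ b → c ≤ d → a + c ≤ b + d
  +-mono-≤₂ {a} {b} {c} {d} a≤b c≤d = ≤-trans (+-mono-≤ c a≤b) (+-monoʳ-≤ b c≤d)

  +-cancelʳ-≤ : ∀ {a b} c → a + c ≤ b + c → a ≤ b
  +-cancelʳ-≤ {a} {b} c a+c≤b+c =
    subst₂ _≤_ (cancel a) (cancel b) (+-mono-≤ (- c) a+c≤b+c)
    where
    cancel : ∀ x → (x + c) − c ≡ x
    cancel x = solve 2 (λ x c → x :+ c :- c := x) refl x c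

  +-mono-≺-≤ : ∀ {a b c d} → a ≺ b → c ≤ d → a + c ≺ b + d
  +-mono-≺-≤ {a} {b} {c} {d} a≺b c≤d b+d≤a+c =
    a≺b (+-cancelʳ-≤ d (≤-trans b+d≤a+c (+-monoʳ-≤ a c≤d)))

  +-nonneg : ∀ {a b} → 0# ≤ a → 0# ≤ b → 0# ≤ a + b
  +-nonneg 0≤a 0≤b = subst (_≤ _) (+-identityʳ 0#) (+-mono-≤₂ 0≤a 0≤b)

  ≤⇒0≤− : ∀ {a b} → a ≤ b → 0# ≤ b − a
  ≤⇒0≤− {a} {b} a≤b = subst (_≤ b − a) (-‿inverseʳ a) (+-mono-≤ (- a) a≤b)

  0≤−⇒≤ : ∀ {a b} → 0# ≤ b − a → a ≤ b
  0≤−⇒≤ {a} {b} 0≤b−a =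
    subst₂ _≤_ (+-identityˡ a) (solve 2 (λ a b → b :- a :+ a := b) refl a b) (+-mono-≤ a 0≤b−a)

  *-monoˡ-≤ : ∀ {a b} c → 0# ≤ c → a ≤ b → c * a ≤ c * b
  *-monoˡ-≤ {a} {b} c 0≤c a≤b = 0≤−⇒≤ (subst (0# ≤_) distrib (*-nonneg 0≤c (≤⇒0≤− a≤b)))
    where
    distrib : c * (b − a) ≡ c * b − c * a
    distrib = solve 3 (λ a b c → c :* (b :- a) := c :* b :- c :* a) refl a b c

  *-monoʳ-≤ : ∀ {a b} c → 0# ≤ c → a ≤ b → a * c ≤ b * c
  *-monoʳ-≤ {a} {b} c 0≤c a≤b = subst₂ _≤_ (*-comm c a) (*-comm c b) (*-monoˡ-≤ c 0≤c a≤b)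

  *-cancelˡ-≺ : ∀ {a b} c → 0# ≤ c → c * a ≺ c * b → a ≺ b
  *-cancelˡ-≺ c 0≤c ca≺cb b≤a = ca≺cb (*-monoˡ-≤ c 0≤c b≤a)

  -- 0# ≤ 1# needs an argument: otherwise -1 ≥ 0 and so 1 = (-1)(-1) ≥ 0 anyway.
  0≤1 : 0# ≤ 1#
  0≤1 with ≤-total 0# 1#
  ... | inj₁ 0≤1 = 0≤1
  ... | inj₂ 1≤0 = ⊥-elim (0≢1 (≤-antisym 0≤1' 1≤0))
    where
    0≤-1 : 0# ≤ - 1#
    0≤-1 = subst₂ _≤_ (-‿inverseʳ 1#) (+-identityˡ (- 1#)) (+-mono-≤ (- 1#) 1≤0)
    0≤1' : 0# ≤ 1#
    0≤1' = subst (0# ≤_) (solve 0 ((:- con (ℤ.+ 1)) :* (:- con (ℤ.+ 1)) := con (ℤ.+ 1)) refl)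
             (*-nonneg 0≤-1 0≤-1)

  0≤4 : 0# ≤ 4#
  0≤4 = +-nonneg 0≤2 0≤2
    where
    0≤2 : 0# ≤ 2#
    0≤2 = +-nonneg 0≤1 0≤1

  a≤4a : ∀ {a} → 0# ≤ a → a ≤ 4# * a
  a≤4a {a} 0≤a = subst₂ _≤_ (+-identityʳ a) (solve 1 (λ a → a :+ (a :+ a :+ a) := :4 :* a) refl a)
                   (+-monoʳ-≤ a (+-nonneg (+-nonneg 0≤a 0≤a) 0≤a))

  4*-mono-≺ : ∀ {a b} → a ≺ b → 4# * a ≺ 4# * b
  4*-mono-≺ {a} {b} a≺b = subst₂ _≺_ (four a) (four b) (+-mono-≺-≤ 2a≺2b (≺⇒≤ 2a≺2b))
    where
    2a≺2b : a + a ≺ b + b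
    2a≺2b = +-mono-≺-≤ a≺b (≺⇒≤ a≺b)
    four : ∀ x → (x + x) + (x + x) ≡ 4# * x
    four = solve 1 (λ x → (x :+ x) :+ (x :+ x) := :4 :* x) refl

  2*-neg : ∀ {a} → a ≺ 0# → 2# * a ≺ 0#
  2*-neg {a} a≺0 = subst₂ _≺_ (solve 1 (λ a → a :+ a := :2 :* a) refl a) (+-identityˡ 0#)
                     (+-mono-≺-≤ a≺0 (≺⇒≤ a≺0))

  fromℕ-nonneg : ∀ n → 0# ≤ fromℕ n
  fromℕ-nonneg zero = ≤-refl
  fromℕ-nonneg (suc n) = subst (0# ≤_) (sym (fromℕ-suc n)) (+-nonneg 0≤1 (fromℕ-nonneg n))

  fromℕ-mono-≤ : ∀ {m n} → m ≤ℕ n → fromℕ m ≤ fromℕ n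
  fromℕ-mono-≤ {m} {n} m≤n with ℕP.m≤n⇒∃[o]m+o≡n m≤n
  ... | k , refl = subst (fromℕ m ≤_) (sym (fromℕ-+ m k))
                     (subst (_≤ fromℕ m + fromℕ k) (+-identityʳ (fromℕ m)) (+-monoʳ-≤ (fromℕ m) (fromℕ-nonneg k)))

  fromℕ-4 : fromℕ 4 ≡ 4#
  fromℕ-4 = solve 0 (con (ℤ.+ 4) := :2 :+ :2) refl

threshold : ℕ → ℕ
threshold zero = 0
threshold (suc k) = 2 ℕ.^ suc k

threshold-double : ∀ k → threshold k ℕ.+ threshold k ≤ℕ threshold (suc k)
threshold-double zero = ℕ.z≤n
threshold-double (suc k) = ℕP.≤-reflexive (cong (2 ℕ.^ suc k ℕ.+_) (sym (ℕP.+-identityʳ _)))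

threshold-+4 : ∀ k → threshold k ℕ.+ 4 ≤ℕ 4 *ℕ threshold (suc k)
threshold-+4 zero = ℕP.m≤m+n 4 4
threshold-+4 (suc k) with 2 ℕ.^ k | ℕP.m^n>0 2 k
... | suc a | _ = subst (2 *ℕ suc a ℕ.+ 4 ≤ℕ_) (eq a) (ℕP.m≤m+n _ (14 *ℕ a ℕ.+ 10))
  where
  open import Data.Nat.Tactic.RingSolver
  eq : ∀ a → 2 *ℕ suc a ℕ.+ 4 ℕ.+ (14 *ℕ a ℕ.+ 10) ≡ 4 *ℕ (2 *ℕ (2 *ℕ suc a))
  eq = solve-∀

threshold-suc-+4 : ∀ k → threshold (suc (suc k)) ℕ.+ 4 ≤ℕ 4 *ℕ threshold (suc k)
threshold-suc-+4 k with 2 ℕ.^ k | ℕP.m^n>0 2 k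
... | suc a | _ = subst (2 *ℕ (2 *ℕ suc a) ℕ.+ 4 ≤ℕ_) (eq a) (ℕP.m≤m+n _ (4 *ℕ a))
  where
  open import Data.Nat.Tactic.RingSolver
  eq : ∀ a → 2 *ℕ (2 *ℕ suc a) ℕ.+ 4 ℕ.+ 4 *ℕ a ≡ 4 *ℕ (2 *ℕ suc a)
  eq = solve-∀

module Surplus (F : RealField) (ε : RealField.R F)
               (0≤ε : RealField._≤_ F (RealField.0# F) ε) (ε≤1 : RealField._≤_ F ε (RealField.1# F)) where
  open OrderedField F

  θ : ℕ → R
  θ m = fromℕ (threshold m)

  θ-nonneg : ∀ m → 0# ≤ θ m
  θ-nonneg m = fromℕ-nonneg (threshold m)

  θ-double : ∀ m → θ m + θ m ≤ θ (suc m)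
  θ-double m = subst (_≤ θ (suc m)) (fromℕ-+ (threshold m) (threshold m)) (fromℕ-mono-≤ (threshold-double m))

  θ-+4 : ∀ m → θ m + 4# ≤ 4# * θ (suc m)
  θ-+4 m = subst₂ _≤_ (trans (fromℕ-+ (threshold m) 4) (cong (θ m +_) fromℕ-4))
                      (trans (fromℕ-* 4 (threshold (suc m))) (cong (_* θ (suc m)) fromℕ-4))
                      (fromℕ-mono-≤ (threshold-+4 m))

  θ-suc-+4 : ∀ k → θ (suc (suc k)) + 4# ≤ 4# * θ (suc k)
  θ-suc-+4 k = subst₂ _≤_ (trans (fromℕ-+ (threshold (suc (suc k))) 4) (cong (θ (suc (suc k)) +_) fromℕ-4))
                          (trans (fromℕ-* 4 (threshold (suc k))) (cong (_* θ (suc k)) fromℕ-4))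
                          (fromℕ-mono-≤ (threshold-suc-+4 k))

  εX≤X : ∀ {X} → 0# ≤ X → ε * X ≤ X
  εX≤X {X} 0≤X = subst (ε * X ≤_) (*-identityˡ X) (*-monoʳ-≤ X 0≤X ε≤1)

  ≺-rescale : ∀ {s c X U} → 0# ≤ X → c + 4# ≤ 4# * s → s * X ≺ X + U → c * X ≺ 4# * U
  ≺-rescale {s} {c} {X} {U} 0≤X c+4≤4s sX≺X+U 4U≤cX =
    4*-mono-≺ sX≺X+U (≤-trans distrib (≤-trans (+-monoʳ-≤ (4# * X) 4U≤cX) 4X+cX≤4sX))
    where
    distrib : 4# * (X + U) ≤ 4# * X + 4# * U
    distrib = ≤-reflexive (solve 2 (λ X U → :4 :* (X :+ U) := :4 :* X :+ :4 :* U) refl X U)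
    4X+cX≤4sX : 4# * X + c * X ≤ 4# * (s * X)
    4X+cX≤4sX = subst₂ _≤_ (solve 2 (λ c X → (c :+ :4) :* X := :4 :* X :+ c :* X) refl c X)
                           (solve 2 (λ s X → (:4 :* s) :* X := :4 :* (s :* X)) refl s X)
                           (*-monoʳ-≤ X 0≤X c+4≤4s)

  -- The surplus of a job of size X grows logarithmically with the volume of
  -- the jobs below it: volume V > θ m · X forces surplus > m.  An active job
  -- only counts the volume U of its completed children, against ε X / 4.
  ActiveSurplus : ℕ → R → R → Set
  ActiveSurplus e U X = ∀ m → θ m * (ε * X) ≺ 4# * U → suc m ≤ℕ e

  activeSurplus-mono : ∀ {e e' U X} → e ≤ℕ e' → ActiveSurplus e U X → ActiveSurplus e' U X
  activeSurplus-mono e≤e' s m big = ℕP.≤-trans (s m big) e≤e'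

  DoneSurplus : ℕ → R → R → Set
  DoneSurplus e V X = ∀ m → θ m * X ≺ V → suc m ≤ℕ e

  doneSurplus⇒activeSurplus : ∀ {N V Xc Xq} → 0# ≤ Xc → DoneSurplus N V Xc → 4# * Xc ≤ ε * Xq →
                              ActiveSurplus N V Xq
  doneSurplus⇒activeSurplus {N} {V} {Xc} {Xq} 0≤Xc surplus 4Xc≤εXq m θεXq≺4V =
    surplus m (*-cancelˡ-≺ 4# 0≤4 (≤-≺-trans 4θXc≤θεXq θεXq≺4V))
    where
    4θXc≤θεXq : 4# * (θ m * Xc) ≤ θ m * (ε * Xq)
    4θXc≤θεXq = subst (_≤ θ m * (ε * Xq)) (solve 2 (λ t x → t :* (:4 :* x) := :4 :* (t :* x)) refl (θ m) Xc)
                      (*-monoˡ-≤ (θ m) (θ-nonneg m) 4Xc≤εXq)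

  -- If neither U nor V alone passes the threshold θ m, then U + V does not
  -- pass θ (suc m) ≥ θ m + θ m; a positive U adds at least one to T.
  activeSurplus-+ : ∀ {T U N V X} → 0# ≤ X → ActiveSurplus T U X → ActiveSurplus N V X → 1 ≤ℕ N →
                    ActiveSurplus (T ℕ.+ N) (U + V) X
  activeSurplus-+ {T} {U} {N} {V} {X} 0≤X sT sN 1≤N zero _ = ℕP.≤-trans 1≤N (ℕP.m≤n+m N T)
  activeSurplus-+ {T} {U} {N} {V} {X} 0≤X sT sN 1≤N (suc m) big with ≺-or-≥ (θ m * (ε * X)) (4# * U)
  ... | inj₁ bigU = subst (_≤ℕ T ℕ.+ N) (cong suc (ℕP.+-comm m 1)) (ℕP.+-mono-≤ (sT m bigU) 1≤N)
  ... | inj₂ smallU with ≺-or-≥ (θ m * (ε * X)) (4# * V)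
  ...   | inj₂ smallV = ⊥-elim (big (≤-trans distrib (≤-trans (+-mono-≤₂ smallU smallV) double)))
    where
    distrib : 4# * (U + V) ≤ 4# * U + 4# * V
    distrib = ≤-reflexive (solve 2 (λ U V → :4 :* (U :+ V) := :4 :* U :+ :4 :* V) refl U V)
    double : θ m * (ε * X) + θ m * (ε * X) ≤ θ (suc m) * (ε * X)
    double = subst (_≤ θ (suc m) * (ε * X)) (distribʳ (ε * X) (θ m) (θ m))
                   (*-monoʳ-≤ (ε * X) (*-nonneg 0≤ε 0≤X) (θ-double m))
  ...   | inj₁ bigV with ≺-or-≥ (θ 0 * (ε * X)) (4# * U)
  ...     | inj₁ U>0 = subst₂ _≤ℕ_ (cong suc (ℕP.+-comm m 1)) (ℕP.+-comm N T)
                         (ℕP.+-mono-≤ (sN m bigV) (sT 0 U>0))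
  ...     | inj₂ U≤0 = ℕP.≤-trans (sN (suc m) (≺-≤-trans big 4[U+V]≤4V)) (ℕP.m≤n+m N T)
    where
    4[U+V]≤4V : 4# * (U + V) ≤ 4# * V
    4[U+V]≤4V = subst₂ _≤_ (solve 2 (λ U V → :4 :* U :+ :4 :* V := :4 :* (U :+ V)) refl U V)
                          (+-identityˡ (4# * V))
                          (+-mono-≤ (4# * V) (subst (4# * U ≤_) (zeroˡ (ε * X)) U≤0))

  activeSurplus⇒doneSurplus-onTime : ∀ {T U X} → 0# ≤ X → ActiveSurplus T U X →
                                     DoneSurplus (suc T) (X + U) X
  activeSurplus⇒doneSurplus-onTime 0≤X s zero _ = ℕ.s≤s ℕ.z≤n
  activeSurplus⇒doneSurplus-onTime 0≤X s (suc m) big =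
    ℕ.s≤s (s m (≤-≺-trans (*-monoˡ-≤ (θ m) (θ-nonneg m) (εX≤X 0≤X)) (≺-rescale 0≤X (θ-+4 m) big)))

  activeSurplus⇒doneSurplus-late : ∀ {T U X} → 0# ≤ X → ActiveSurplus T U X →
                                   θ 1 * (ε * X) ≺ 4# * U →
                                   ∀ m → θ m * X ≺ X + U → suc (suc m) ≤ℕ T
  activeSurplus⇒doneSurplus-late 0≤X s late zero _ = s 1 late
  activeSurplus⇒doneSurplus-late 0≤X s late (suc k) big =
    s (suc (suc k)) (≤-≺-trans (*-monoˡ-≤ (θ (suc (suc k))) (θ-nonneg (suc (suc k))) (εX≤X 0≤X))
                               (≺-rescale 0≤X (θ-suc-+4 k) big))

module FinSum (M : CommutativeMonoid 0ℓ 0ℓ) where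
  open CommutativeMonoid M using (Carrier; _≈_)
    renaming (_∙_ to _+_; ε to 0#; refl to ≈-refl; sym to ≈-sym; trans to ≈-trans;
              ∙-cong to +-cong; ∙-congʳ to +-congʳ; identityˡ to +-identityˡ;
              identityʳ to +-identityʳ; assoc to +-assoc)
  open import Algebra.Properties.CommutativeMonoid.Sum M public
  open import Algebra.Solver.CommutativeMonoid M using (solve; _⊕_; _⊜_)
  open import Relation.Binary.Reasoning.Setoid (CommutativeMonoid.setoid M)

  sum-zero : ∀ {n} {f : Vector Carrier n} → (∀ x → f x ≈ 0#) → sum f ≈ 0#
  sum-zero {zero} _ = ≈-refl
  sum-zero {suc n} f≈0 = ≈-trans (+-cong (f≈0 fz) (sum-zero (λ x → f≈0 (fs x)))) (+-identityˡ 0#)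

  sum-update : ∀ {n} {f g : Vector Carrier n} c → (∀ x → x ≢ c → g x ≈ f x) →
               sum g + f c ≈ sum f + g c
  sum-update {suc n} {f} {g} fz g≈f = begin
    (g fz + sum (λ x → g (fs x))) + f fz ≈⟨ +-congʳ (+-cong ≈-refl (sum-cong-≋ (λ x → g≈f (fs x) (λ ())))) ⟩
    (g fz + sum (λ x → f (fs x))) + f fz ≈⟨ solve 3 (λ a b c → (a ⊕ b) ⊕ c ⊜ (c ⊕ b) ⊕ a) ≈-refl (g fz) _ (f fz) ⟩
    (f fz + sum (λ x → f (fs x))) + g fz ∎
  sum-update {suc n} {f} {g} (fs c) g≈f = begin
    (g fz + sum (λ x → g (fs x))) + f (fs c) ≈⟨ +-assoc _ _ _ ⟩
    g fz + (sum (λ x → g (fs x)) + f (fs c)) ≈⟨ +-cong (g≈f fz (λ ())) (sum-update c (λ x x≢c → g≈f (fs x) (λ e → x≢c (FinP.suc-injective e)))) ⟩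
    f fz + (sum (λ x → f (fs x)) + g (fs c)) ≈⟨ ≈-sym (+-assoc _ _ _) ⟩
    (f fz + sum (λ x → f (fs x))) + g (fs c) ∎

  sum-single : ∀ {n} {f : Vector Carrier n} c → (∀ x → x ≢ c → f x ≈ 0#) → sum f ≈ f c
  sum-single {n} {f} c f≈0 = begin
    sum f                  ≈⟨ ≈-sym (+-identityʳ (sum f)) ⟩
    sum f + 0#             ≈⟨ sum-update {n} {λ _ → 0#} {f} c f≈0 ⟩
    sum {n} (λ _ → 0#) + f c ≈⟨ +-congʳ (sum-zero {n} {λ _ → 0#} (λ _ → ≈-refl)) ⟩
    0# + f c               ≈⟨ +-identityˡ (f c) ⟩
    f c                    ∎

module ∑ℕ = FinSum ℕP.+-0-commutativeMonoid

sum-mono-≤ : ∀ {n} {f g : Vector ℕ n} → (∀ x → f x ≤ℕ g x) → ∑ℕ.sum f ≤ℕ ∑ℕ.sum g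
sum-mono-≤ {zero} _ = ℕ.z≤n
sum-mono-≤ {suc n} f≤g = ℕP.+-mono-≤ (f≤g fz) (sum-mono-≤ (λ x → f≤g (fs x)))

count≡sum : ∀ {n} (f : Fin n → Bool) → count f ≡ ∑ℕ.sum (λ x → if f x then 1 else 0)
count≡sum {zero} f = refl
count≡sum {suc n} f = cong ((if f fz then 1 else 0) ℕ.+_) (count≡sum (λ x → f (fs x)))

module Invariant (F : RealField) (ε : RealField.R F)
                 (0≤ε : RealField._≤_ F (RealField.0# F) ε) (ε≤1 : RealField._≤_ F ε (RealField.1# F))
                 {m n : ℕ} (I : Instance F m n) where
  open OrderedField F
  open Surplus F ε 0≤ε ε≤1
  module ∑R = FinSum +-commutativeMonoid
  open Instance I
  open Region F I ε

  JobStatus : Set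
  JobStatus = Status F m

  done≢active : ∀ {i t i' r} → _≢_ {A = JobStatus} (done i t) (active i' r)
  done≢active ()

  active≢done : ∀ {i r i' t} → _≢_ {A = JobStatus} (active i r) (done i' t)
  active≢done ()

  done≢pending : ∀ {i t} → _≢_ {A = JobStatus} (done i t) pending
  done≢pending ()

  active≢pending : ∀ {i r} → _≢_ {A = JobStatus} (active i r) pending
  active≢pending ()

  pending≢done : ∀ {i t} → _≢_ {A = JobStatus} pending (done i t)
  pending≢done ()

  -- parent c is the job that c preempted at its admission (nothing if the
  -- machine was idle) and size c = p_ic; blocked c is the time c has waited
  -- since its admission.  For a completed job, volume is the total size of
  -- the tree of jobs below it and surplus is 2·(on-time) − (admitted) there.
  record Ghost : Set where
    constructor ghost
    field
      parent : Fin n → Maybe (Fin n)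
      size blocked volume : Fin n → R
      surplus : Fin n → ℕ
  open Ghost

  -- The value x of a job c with parent q and status s, as a term in the
  -- sum over the children of j: nonzero only if c is completed and q = j.
  module Contribution {A : Set} (0ᴬ : A) where
    whenDone : JobStatus → A → A
    whenDone (done _ _) x = x
    whenDone _ _ = 0ᴬ

    contribution : Maybe (Fin n) → Fin n → JobStatus → A → A
    contribution q j (done _ _) x = if does (MaybeP.≡-dec Fin._≟_ q (just j)) then x else 0ᴬ
    contribution q j _ _ = 0ᴬ

    contribution-other : ∀ {q} j s x → q ≢ just j → contribution q j s x ≡ 0ᴬ
    contribution-other {q} j (done _ _) x q≢j with MaybeP.≡-dec Fin._≟_ q (just j)
    ... | yes q≡j = ⊥-elim (q≢j q≡j)
    ... | no _ = refl
    contribution-other j pending x _ = refl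
    contribution-other j (active _ _) x _ = refl

    contribution-self : ∀ j s x → contribution (just j) j s x ≡ whenDone s x
    contribution-self j (done _ _) x with j Fin.≟ j
    ... | yes _ = refl
    ... | no j≢j = ⊥-elim (j≢j refl)
    contribution-self j pending x = refl
    contribution-self j (active _ _) x = refl

    contribution-0 : ∀ q j s → contribution q j s 0ᴬ ≡ 0ᴬ
    contribution-0 q j (done _ _) with does (MaybeP.≡-dec Fin._≟_ q (just j))
    ... | true = refl
    ... | false = refl
    contribution-0 q j pending = refl
    contribution-0 q j (active _ _) = refl

  open Contribution 0# public
  open Contribution 0 public using () renaming
    (whenDone to whenDoneℕ; contribution to contributionℕ;
     contribution-other to contributionℕ-other; contribution-self to contributionℕ-self)

  childSurplus : (Fin n → JobStatus) → Ghost → Fin n → ℕ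
  childSurplus σ g j = ∑ℕ.sum (λ c → contributionℕ (parent g c) j (σ c) (surplus g c))
  childVolume : (Fin n → JobStatus) → Ghost → Fin n → R
  childVolume σ g j = ∑R.sum (λ c → contribution (parent g c) j (σ c) (volume g c))

  NoActiveChild : (Fin n → JobStatus) → Ghost → Fin n → Set
  NoActiveChild σ g k = ∀ c i' rc → parent g c ≡ just k → σ c ≢ active i' rc

  -- A job waits only while one of its children is active, so its waiting
  -- time is the volume of its completed children plus the progress of the
  -- active one.
  BlockedInv : (Fin n → JobStatus) → Ghost → Fin n → Fin m → Set
  BlockedInv σ g k i =
    (NoActiveChild σ g k × blocked g k ≡ childVolume σ g k) ⊎
    (∃ λ c → ∃ λ rc → parent g c ≡ just k × σ c ≡ active i rc ×
                      blocked g k ≡ childVolume σ g k + (size g c − rc + blocked g c))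

  record ActiveInv (τ : R) (σ : Fin n → JobStatus) (g : Ghost) (k : Fin n) (i : Fin m) (r : R) : Set where
    field
      act-size : p i k ≡ just (size g k)
      -- (1 + ε/2) p ≤ d − (admission time), the elapsed time being split
      -- into processing (p − r) and waiting (blocked).
      act-slack : (2# + ε) * size g k ≤ 2# * (d k − τ + size g k − r + blocked g k)
      act-blocked : BlockedInv σ g k i
      act-surplus : ActiveSurplus (childSurplus σ g k) (childVolume σ g k) (size g k)
      act-parent : ∀ q → parent g k ≡ just q → (∃ λ rq → σ q ≡ active i rq) × (4# * size g k ≺ ε * size g q)

  record DoneInv (σ : Fin n → JobStatus) (g : Ghost) (k : Fin n) (i : Fin m) (t : R) : Set where
    field
      done-size : p i k ≡ just (size g k)
      done-children : ∀ c → parent g c ≡ just k → ∃ λ i' → ∃ λ t' → σ c ≡ done i' t'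
      done-surplus-pos : 1 ≤ℕ surplus g k
      done-surplus : DoneSurplus (surplus g k) (volume g k) (size g k)
      done-onTime : t ≤ d k → surplus g k ≡ suc (childSurplus σ g k)
      done-late : ¬ (t ≤ d k) → suc (surplus g k) ≡ childSurplus σ g k
      done-parent : ∀ q → parent g k ≡ just q → 4# * size g k ≤ ε * size g q

  record Inv (τ : R) (σ : Fin n → JobStatus) (g : Ghost) : Set where
    field
      pending-orphan : ∀ k → σ k ≡ pending → parent g k ≡ nothing
      parent-admitted : ∀ c q → parent g c ≡ just q → σ q ≢ pending
      active-inv : ∀ k i r → σ k ≡ active i r → ActiveInv τ σ g k i r
      done-inv : ∀ k i t → σ k ≡ done i t → DoneInv σ g k i t
      -- the active jobs of a machine form one chain of preemptions
      sizes-distinct : ∀ j k i r r' → σ j ≡ active i r → σ k ≡ active i r' → size g j ≡ size g k → j ≡ k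
      larger-has-child : ∀ j k i r r' → σ j ≡ active i r → σ k ≡ active i r' → size g k ≺ size g j →
           ∃ λ c → ∃ λ rc → parent g c ≡ just j × σ c ≡ active i rc × size g k ≤ size g c
      active-child-unique : ∀ c c' j i i' r r' → parent g c ≡ just j → parent g c' ≡ just j → σ c ≡ active i r → σ c' ≡ active i' r' → c ≡ c'

  ghost₀ : Ghost
  ghost₀ = ghost (λ _ → nothing) (λ _ → 0#) (λ _ → 0#) (λ _ → 0#) (λ _ → 0)

  inv-initial : ∀ τ → Inv τ (λ _ → pending) ghost₀
  inv-initial τ = record
    { pending-orphan = λ _ _ → refl
    ; parent-admitted = λ _ _ ()
    ; active-inv = λ _ _ _ ()
    ; done-inv = λ _ _ _ ()
    ; sizes-distinct = λ _ _ _ _ _ ()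
    ; larger-has-child = λ _ _ _ _ _ ()
    ; active-child-unique = λ _ _ _ _ _ _ _ ()
    }

  admittedℕ : JobStatus → ℕ
  admittedℕ s = if isAdmitted s then 1 else 0

  onTimeℕ : Fin n → JobStatus → ℕ
  onTimeℕ k s = if onTime k s then 1 else 0

  whenDoneℕ-≤ : ∀ s x → whenDoneℕ s x ≤ℕ x
  whenDoneℕ-≤ pending x = ℕ.z≤n
  whenDoneℕ-≤ (active _ _) x = ℕ.z≤n
  whenDoneℕ-≤ (done _ _) x = ℕP.≤-refl

  contributions-≤ : ∀ q s x → ∑ℕ.sum (λ k → contributionℕ q k s x) ≤ℕ whenDoneℕ s x
  contributions-≤ nothing s x =
    ℕP.≤-trans (ℕP.≤-reflexive (∑ℕ.sum-zero (λ k → contributionℕ-other k s x (λ ())))) ℕ.z≤n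
  contributions-≤ (just q) s x = ℕP.≤-reflexive (trans
    (∑ℕ.sum-single q (λ k k≢q → contributionℕ-other k s x (λ e → k≢q (sym (MaybeP.just-injective e)))))
    (contributionℕ-self q s x))

  -- Each completed job is counted in the child sum of its parent only.
  childSurplus-total≤surplus-total : ∀ σ g →
    ∑ℕ.sum (λ k → whenDoneℕ (σ k) (childSurplus σ g k)) ≤ℕ ∑ℕ.sum (λ k → whenDoneℕ (σ k) (surplus g k))
  childSurplus-total≤surplus-total σ g = begin
    ∑ℕ.sum (λ k → whenDoneℕ (σ k) (childSurplus σ g k))
      ≤⟨ sum-mono-≤ (λ k → whenDoneℕ-≤ (σ k) (childSurplus σ g k)) ⟩
    ∑ℕ.sum (λ k → ∑ℕ.sum (λ c → contributionℕ (parent g c) k (σ c) (surplus g c)))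
      ≡⟨ ∑ℕ.∑-comm (λ k c → contributionℕ (parent g c) k (σ c) (surplus g c)) ⟩
    ∑ℕ.sum (λ c → ∑ℕ.sum (λ k → contributionℕ (parent g c) k (σ c) (surplus g c)))
      ≤⟨ sum-mono-≤ (λ c → contributions-≤ (parent g c) (σ c) (surplus g c)) ⟩
    ∑ℕ.sum (λ c → whenDoneℕ (σ c) (surplus g c)) ∎
    where open ℕP.≤-Reasoning

  surplus-balance : ∀ {τ σ g} → Inv τ σ g → ∀ k → (∀ i r → σ k ≢ active i r) →
                    whenDoneℕ (σ k) (surplus g k) ℕ.+ admittedℕ (σ k) ≡
                    whenDoneℕ (σ k) (childSurplus σ g k) ℕ.+ (onTimeℕ k (σ k) ℕ.+ onTimeℕ k (σ k))
  surplus-balance {σ = σ} {g} inv k notActive with σ k in σk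
  ... | pending = refl
  ... | active i r = ⊥-elim (notActive i r refl)
  ... | done i t with t ≤? d k
  ...   | yes t≤d = trans (cong (ℕ._+ 1) (DoneInv.done-onTime D t≤d)) (sym (ℕP.+-suc _ 1))
    where D = Inv.done-inv inv k i t σk
  ...   | no t≰d = trans (ℕP.+-comm (surplus g k) 1) (trans (DoneInv.done-late D t≰d) (sym (ℕP.+-identityʳ _)))
    where D = Inv.done-inv inv k i t σk

  -- Summing the balance over all jobs: Σ surplus + #admitted = Σ childSurplus + 2 #onTime.
  admitted≤2*onTime : ∀ τ σ g → Inv τ σ g → (∀ k i r → σ k ≢ active i r) →
                      count (λ j → isAdmitted (σ j)) ≤ℕ 2 *ℕ count (λ j → onTime j (σ j))
  admitted≤2*onTime τ σ g inv noActive
    rewrite count≡sum (λ j → isAdmitted (σ j)) | count≡sum (λ j → onTime j (σ j))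
          | ℕP.+-identityʳ (∑ℕ.sum (λ j → onTimeℕ j (σ j))) =
    ℕP.+-cancelˡ-≤ (∑ℕ.sum own) A (O ℕ.+ O) (begin
      ∑ℕ.sum own ℕ.+ A                           ≡⟨ sym (∑ℕ.∑-distrib-+ own admitted) ⟩
      ∑ℕ.sum (λ k → own k ℕ.+ admitted k)        ≡⟨ ∑ℕ.sum-cong-≗ (λ k → surplus-balance inv k (noActive k)) ⟩
      ∑ℕ.sum (λ k → children k ℕ.+ (onTime' k ℕ.+ onTime' k))
        ≡⟨ ∑ℕ.∑-distrib-+ children (λ k → onTime' k ℕ.+ onTime' k) ⟩
      ∑ℕ.sum children ℕ.+ ∑ℕ.sum (λ k → onTime' k ℕ.+ onTime' k)
        ≡⟨ cong (∑ℕ.sum children ℕ.+_) (∑ℕ.∑-distrib-+ onTime' onTime') ⟩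
      ∑ℕ.sum children ℕ.+ (O ℕ.+ O)              ≤⟨ ℕP.+-monoˡ-≤ (O ℕ.+ O) (childSurplus-total≤surplus-total σ g) ⟩
      ∑ℕ.sum own ℕ.+ (O ℕ.+ O)                   ∎)
    where
    open ℕP.≤-Reasoning
    own children admitted onTime' : Fin n → ℕ
    own k = whenDoneℕ (σ k) (surplus g k)
    children k = whenDoneℕ (σ k) (childSurplus σ g k)
    admitted k = admittedℕ (σ k)
    onTime' k = onTimeℕ k (σ k)
    A O : ℕ
    A = ∑ℕ.sum admitted
    O = ∑ℕ.sum onTime'

  active-injective : ∀ {i i' : Fin m} {r r'} → _≡_ {A = JobStatus} (active i r) (active i' r') → i ≡ i' × r ≡ r'
  active-injective refl = refl , refl
  done-injective : ∀ {i i' : Fin m} {r r'} → _≡_ {A = JobStatus} (done i r) (done i' r') → i ≡ i' × r ≡ r'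
  done-injective refl = refl , refl

  set : ∀ {A : Set} → (Fin n → A) → Fin n → A → Fin n → A
  set f j v k with k Fin.≟ j
  ... | yes _ = v
  ... | no _ = f k

  set-≡ : ∀ {A : Set} (f : Fin n → A) j v → set f j v j ≡ v
  set-≡ f j v with j Fin.≟ j
  ... | yes _ = refl
  ... | no j≢j = ⊥-elim (j≢j refl)

  set-≢ : ∀ {A : Set} (f : Fin n → A) j v k → k ≢ j → set f j v k ≡ f k
  set-≢ f j v k k≢j with k Fin.≟ j
  ... | yes k≡j = ⊥-elim (k≢j k≡j)
  ... | no _ = refl

  module InvFacts {τ : R} {σ : Fin n → JobStatus} {g : Ghost} (inv : Inv τ σ g) where
    open Inv inv

    size-nonneg : ∀ {k i r} → σ k ≡ active i r → 0# ≤ size g k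
    size-nonneg {k} {i} {r} e = p-nonneg i k (size g k) (ActiveInv.act-size (active-inv k i r e))

    current-size : ∀ {i c y} → Current (τ , σ) i c y → y ≡ size g c
    current-size {i} {c} {y} ((rem , e) , pc , _) = MaybeP.just-injective (trans (sym pc) (ActiveInv.act-size (active-inv c i rem e)))

    current-minimal : ∀ {i c y k rk} → Current (τ , σ) i c y → σ k ≡ active i rk → size g c ≤ size g k
    current-minimal {i} {c} {y} {k} {rk} cur@(_ , _ , mn) ek =
      subst (_≤ size g k) (current-size cur) (mn k (size g k) (rk , ek) (ActiveInv.act-size (active-inv k i rk ek)))

    current-noActiveChild : ∀ {i c y} → Current (τ , σ) i c y → NoActiveChild σ g c
    current-noActiveChild {i} {c} {y} cur@((rem , ec) , _ , _) c' i' rc pc' ec' with ActiveInv.act-parent (active-inv c' i' rc ec') c pc'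
    ... | (rq , ec2) , lt with active-injective (trans (sym ec) ec2)
    ... | refl , refl = lt (≤-trans (εX≤X (size-nonneg ec)) (≤-trans (current-minimal cur ec') (a≤4a (size-nonneg ec'))))

  admittedStatus-cases : ∀ {i τ x s} → AdmittedStatus i τ x s → (x ≡ 0# × s ≡ done i τ) ⊎ (x ≢ 0# × s ≡ active i x)
  admittedStatus-cases (adm-zero e) = inj₁ (e , refl)
  admittedStatus-cases (adm-pos ne) = inj₂ (ne , refl)

  Preempts : R → (Fin n → JobStatus) → Ghost → Fin m → R → Maybe (Fin n) → Set
  Preempts τ σ g i x nothing = Idle (τ , σ) i
  Preempts τ σ g i x (just c) = Current (τ , σ) i c (size g c) × 4# * x ≺ ε * size g c

  preempts-just : ∀ {τ σ g i x} pr' q → pr' ≡ just q → Preempts τ σ g i x pr' → Current (τ , σ) i q (size g q) × 4# * x ≺ ε * size g q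
  preempts-just (just c) .c refl h = h

  preempts-view : ∀ {τ σ g i x} pr' → Preempts τ σ g i x pr' →
           (pr' ≡ nothing × Idle (τ , σ) i) ⊎ (∃ λ c → pr' ≡ just c × Current (τ , σ) i c (size g c) × 4# * x ≺ ε * size g c)
  preempts-view nothing h = inj₁ (refl , h)
  preempts-view (just c) (cur , lt) = inj₂ (c , refl , cur , lt)

  module AdmitPreserves {τ : R} {σ σ' : Fin n → JobStatus} {g : Ghost} (inv : Inv τ σ g)
                    (i : Fin m) (j : Fin n) (x : R) (preempted : Maybe (Fin n)) (preempts : Preempts τ σ g i x preempted)
                    (avail : Available (τ , σ) i j x) (admittedAs : AdmittedStatus i τ x (σ' j))
                    (unchanged : ∀ k → k ≢ j → σ' k ≡ σ k) where
    open Inv inv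
    open InvFacts inv

    σj≡pending : σ j ≡ pending
    σj≡pending = proj₁ avail
    pij≡x : p i j ≡ just x
    pij≡x = proj₁ (proj₂ (proj₂ avail))
    admission-slack : (2# + ε) * x ≤ 2# * (d j − τ)
    admission-slack = proj₂ (proj₂ (proj₂ avail))
    0≤x : 0# ≤ x
    0≤x = p-nonneg i j x pij≡x

    g' : Ghost
    g' = ghost (set (parent g) j preempted) (set (size g) j x) (set (blocked g) j 0#) (set (volume g) j 0#) (set (surplus g) j 1)

    j-childless : ∀ c → parent g c ≢ just j
    j-childless c e = parent-admitted c j e σj≡pending

    preempted-active : ∀ q → preempted ≡ just q → ∃ λ rq → σ q ≡ active i rq
    preempted-active q refl = proj₁ (proj₁ preempts)

    admitted⇒≢j : ∀ {k} {s : JobStatus} → σ k ≡ s → s ≢ pending → k ≢ j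
    admitted⇒≢j {k} e sn refl = sn (trans (sym e) σj≡pending)

    active⇒≢j : ∀ {k i' r} → σ k ≡ active i' r → k ≢ j
    active⇒≢j e = admitted⇒≢j e (λ ())

    preempted≢j : ∀ q → preempted ≡ just q → q ≢ j
    preempted≢j q e = active⇒≢j (proj₂ (preempted-active q e))

    σ'j≢pending : σ' j ≢ pending
    σ'j≢pending e with admittedStatus-cases admittedAs
    ... | inj₁ (_ , d) = done≢pending (trans (sym d) e)
    ... | inj₂ (_ , d) = active≢pending (trans (sym d) e)

    admitted-stays : ∀ q → σ q ≢ pending → σ' q ≢ pending
    admitted-stays q h with q Fin.≟ j
    ... | yes refl = σ'j≢pending
    ... | no ne = λ e → h (trans (sym (unchanged q ne)) e)

    parent'≡parent : ∀ c → c ≢ j → set (parent g) j preempted c ≡ parent g c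
    parent'≡parent c ne = set-≢ (parent g) j preempted c ne

    x≺active-sizes : ∀ k rk → σ k ≡ active i rk → x ≺ size g k
    x≺active-sizes = new-small-gen preempted preempts
      where
      new-small-gen : ∀ pr' → Preempts τ σ g i x pr' → ∀ k rk → σ k ≡ active i rk → x ≺ size g k
      new-small-gen nothing idle k rk ek = ⊥-elim (idle k (rk , ek))
      new-small-gen (just c) (cur , lt) k rk ek = ≤-≺-trans (a≤4a 0≤x) (≺-≤-trans lt (≤-trans (εX≤X (size-nonneg (proj₂ (proj₁ cur)))) (current-minimal cur ek)))

    childVolume'≡childVolume : ∀ k → childVolume σ' g' k ≡ childVolume σ g k
    childVolume'≡childVolume k = ∑R.sum-cong-≗ pt
      where
      pt : ∀ c → contribution (set (parent g) j preempted c) k (σ' c) (set (volume g) j 0# c) ≡ contribution (parent g c) k (σ c) (volume g c)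
      pt c with c Fin.≟ j
      ... | yes refl = trans (contribution-0 preempted k (σ' j)) (sym (cong (λ s → contribution (parent g j) k s (volume g j)) σj≡pending))
      ... | no ne = cong (λ s → contribution (parent g c) k s (volume g c)) (unchanged c ne)

    childSurplus'-+ : ∀ k → childSurplus σ' g' k ℕ.+ 0 ≡ childSurplus σ g k ℕ.+ contributionℕ preempted k (σ' j) 1
    childSurplus'-+ k = subst₂ (λ a b → childSurplus σ' g' k ℕ.+ a ≡ childSurplus σ g k ℕ.+ b) e1 e2 (∑ℕ.sum-update j pt)
      where
      pt : ∀ c → c ≢ j → contributionℕ (set (parent g) j preempted c) k (σ' c) (set (surplus g) j 1 c) ≡ contributionℕ (parent g c) k (σ c) (surplus g c)
      pt c ne rewrite set-≢ (parent g) j preempted c ne | set-≢ (surplus g) j 1 c ne | unchanged c ne = refl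
      e1 : contributionℕ (parent g j) k (σ j) (surplus g j) ≡ 0
      e1 rewrite σj≡pending = refl
      e2 : contributionℕ (set (parent g) j preempted j) k (σ' j) (set (surplus g) j 1 j) ≡ contributionℕ preempted k (σ' j) 1
      e2 rewrite set-≡ (parent g) j preempted | set-≡ (surplus g) j 1 = refl

    childSurplus'≡childSurplus : ∀ k → preempted ≢ just k → childSurplus σ' g' k ≡ childSurplus σ g k
    childSurplus'≡childSurplus k ne = trans (sym (ℕP.+-identityʳ _)) (trans (childSurplus'-+ k) (trans (cong (childSurplus σ g k ℕ.+_) (contributionℕ-other k (σ' j) 1 ne)) (ℕP.+-identityʳ _)))

    childSurplus-j≡0 : childSurplus σ g j ≡ 0
    childSurplus-j≡0 = ∑ℕ.sum-zero (λ c → contributionℕ-other j (σ c) (surplus g c) (j-childless c))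
    childVolume-j≡0 : childVolume σ g j ≡ 0#
    childVolume-j≡0 = ∑R.sum-zero (λ c → contribution-other j (σ c) (volume g c) (j-childless c))

    preempted≢just-j : preempted ≢ just j
    preempted≢just-j e = preempted≢j j e refl

    childSurplus'-j≡0 : childSurplus σ' g' j ≡ 0
    childSurplus'-j≡0 = trans (childSurplus'≡childSurplus j preempted≢just-j) childSurplus-j≡0
    childVolume'-j≡0 : childVolume σ' g' j ≡ 0#
    childVolume'-j≡0 = trans (childVolume'≡childVolume j) childVolume-j≡0

    j-childless' : ∀ c → set (parent g) j preempted c ≢ just j
    j-childless' c e = helper (c Fin.≟ j)
      where
      helper : Dec (c ≡ j) → ⊥
      helper (yes eq) = preempted≢just-j (trans (sym (set-≡ (parent g) j preempted)) (subst (λ z → set (parent g) j preempted z ≡ just j) eq e))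
      helper (no ne) = j-childless c (trans (sym (parent'≡parent c ne)) e)

    case-j : ∀ {A : Set} c → (c ≡ j → A) → (c ≢ j → A) → A
    case-j c f h with c Fin.≟ j
    ... | yes e = f e
    ... | no ne = h ne

    preempted-current : ∀ q → preempted ≡ just q → Current (τ , σ) i q (size g q) × 4# * x ≺ ε * size g q
    preempted-current q e = preempts-just preempted q e preempts

    0≤θεx : ∀ mm → 0# ≤ θ mm * (ε * x)
    0≤θεx mm = *-nonneg (θ-nonneg mm) (*-nonneg 0≤ε 0≤x)

    active-inv-j : ∀ i₁ r → σ' j ≡ active i₁ r → ActiveInv τ σ' g' j i₁ r
    active-inv-j i₁ r e with admittedStatus-cases admittedAs
    ... | inj₁ (_ , dj) = ⊥-elim (done≢active (trans (sym dj) e))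
    ... | inj₂ (xne , aj) with active-injective (trans (sym aj) e)
    ... | refl , refl = record
      { act-size = subst (λ z → p i j ≡ just z) (sym (set-≡ (size g) j x)) pij≡x
      ; act-slack = subst₂ (λ a b → (2# + ε) * a ≤ 2# * (d j − τ + a − x + b)) (sym (set-≡ (size g) j x)) (sym (set-≡ (blocked g) j 0#))
                (subst (λ z → (2# + ε) * x ≤ 2# * z) (solve 3 (λ dd t a → (dd :- t) := ((dd :- t) :+ a :- a :+ con (ℤ.+ 0))) refl (d j) τ x) admission-slack)
      ; act-blocked = inj₁ ((λ c i' rc pc _ → j-childless' c pc) , trans (set-≡ (blocked g) j 0#) (sym childVolume'-j≡0))
      ; act-surplus = λ mm h → ⊥-elim (h (subst₂ _≤_ (trans (sym (zeroʳ 4#)) (cong (4# *_) (sym childVolume'-j≡0))) (cong (λ z → θ mm * (ε * z)) (sym (set-≡ (size g) j x))) (0≤θεx mm)))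
      ; act-parent = λ q pq → apar q (trans (sym (set-≡ (parent g) j preempted)) pq)
      }
      where
      apar : ∀ q → preempted ≡ just q → (∃ λ rq → σ' q ≡ active i rq) × (4# * set (size g) j x j ≺ ε * set (size g) j x q)
      apar q e with preempted-current q e
      ... | cur , lt = (proj₁ (proj₁ cur) , trans (unchanged q (preempted≢j q e)) (proj₂ (proj₁ cur))) ,
                       subst₂ (λ a b → 4# * a ≺ ε * b) (sym (set-≡ (size g) j x)) (sym (set-≢ (size g) j x q (preempted≢j q e))) lt

    childSurplus≤childSurplus' : ∀ k → childSurplus σ g k ≤ℕ childSurplus σ' g' k
    childSurplus≤childSurplus' k = ℕP.≤-trans (ℕP.m≤m+n (childSurplus σ g k) (contributionℕ preempted k (σ' j) 1))
               (ℕP.≤-reflexive (trans (sym (childSurplus'-+ k)) (ℕP.+-identityʳ _)))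

    blocked-inv-other : ∀ k → k ≢ j → ∀ i₁ r → σ k ≡ active i₁ r → BlockedInv σ g k i₁ → BlockedInv σ' g' k i₁
    blocked-inv-other k k≢j i₁ r ek (inj₂ (c₁ , rc , pc , ec , beq)) =
      inj₂ (c₁ , rc , trans (parent'≡parent c₁ c₁≢j) pc , trans (unchanged c₁ c₁≢j) ec ,
            subst₂ (λ a u → a ≡ u + (set (size g) j x c₁ − rc + set (blocked g) j 0# c₁))
                   (sym (set-≢ (blocked g) j 0# k k≢j)) (sym (childVolume'≡childVolume k))
                   (subst₂ (λ a b → blocked g k ≡ childVolume σ g k + (a − rc + b))
                           (sym (set-≢ (size g) j x c₁ c₁≢j)) (sym (set-≢ (blocked g) j 0# c₁ c₁≢j)) beq))
      where c₁≢j = active⇒≢j ec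
    blocked-inv-other k k≢j i₁ r ek (inj₁ (na , bu)) with MaybeP.≡-dec Fin._≟_ preempted (just k) | admittedStatus-cases admittedAs
    ... | yes prk | inj₂ (_ , aj) = inj₂ (j , x , trans (set-≡ (parent g) j preempted) prk , trans aj (cong (λ z → active z x) i≡i₁) ,
            trans (set-≢ (blocked g) j 0# k k≢j) (trans bu (trans (sym (childVolume'≡childVolume k))
              (subst₂ (λ a b → childVolume σ' g' k ≡ childVolume σ' g' k + (a − x + b)) (sym (set-≡ (size g) j x)) (sym (set-≡ (blocked g) j 0#))
                (solve 2 (λ u a → u := u :+ (a :- a :+ con (ℤ.+ 0))) refl (childVolume σ' g' k) x)))))
      where
      i≡i₁ : i ≡ i₁
      i≡i₁ = proj₁ (active-injective (trans (sym (proj₂ (preempted-active k prk))) ek))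
    ... | yes prk | inj₁ (_ , dj) = inj₁ (na' , bu')
      where
      na' : NoActiveChild σ' g' k
      na' c i' rc pc ec = case-j c (λ eq → done≢active (trans (sym dj) (subst (λ z → σ' z ≡ active i' rc) eq ec)))
                                (λ c≠ → na c i' rc (trans (sym (parent'≡parent c c≠)) pc) (trans (sym (unchanged c c≠)) ec))
      bu' : set (blocked g) j 0# k ≡ childVolume σ' g' k
      bu' = trans (set-≢ (blocked g) j 0# k k≢j) (trans bu (sym (childVolume'≡childVolume k)))
    ... | no prk | _ = inj₁ (na' , bu')
      where
      na' : NoActiveChild σ' g' k
      na' c i' rc pc ec = case-j c (λ eq → prk (trans (sym (set-≡ (parent g) j preempted)) (subst (λ z → set (parent g) j preempted z ≡ just k) eq pc)))
                                (λ c≠ → na c i' rc (trans (sym (parent'≡parent c c≠)) pc) (trans (sym (unchanged c c≠)) ec))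
      bu' : set (blocked g) j 0# k ≡ childVolume σ' g' k
      bu' = trans (set-≢ (blocked g) j 0# k k≢j) (trans bu (sym (childVolume'≡childVolume k)))

    active-inv-other : ∀ k → k ≢ j → ∀ i₁ r → σ' k ≡ active i₁ r → ActiveInv τ σ' g' k i₁ r
    active-inv-other k ne i₁ r e = record
      { act-size = subst (λ z → p i₁ k ≡ just z) (sym (set-≢ (size g) j x k ne)) (act-size A)
      ; act-slack = subst₂ (λ a b → (2# + ε) * a ≤ 2# * (d k − τ + a − r + b)) (sym (set-≢ (size g) j x k ne)) (sym (set-≢ (blocked g) j 0# k ne)) (act-slack A)
      ; act-blocked = blocked-inv-other k ne i₁ r ek (act-blocked A)
      ; act-surplus = subst₂ (λ u z → ActiveSurplus (childSurplus σ' g' k) u z) (sym (childVolume'≡childVolume k)) (sym (set-≢ (size g) j x k ne)) (activeSurplus-mono (childSurplus≤childSurplus' k) (act-surplus A))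
      ; act-parent = λ q pq → apar q (trans (sym (parent'≡parent k ne)) pq)
      }
      where
      ek : σ k ≡ active i₁ r
      ek = trans (sym (unchanged k ne)) e
      A = active-inv k i₁ r ek
      open ActiveInv
      apar : ∀ q → parent g k ≡ just q → (∃ λ rq → σ' q ≡ active i₁ rq) × (4# * set (size g) j x k ≺ ε * set (size g) j x q)
      apar q pq with act-parent A q pq
      ... | (rq , eq) , lt = (rq , trans (unchanged q (active⇒≢j eq)) eq) ,
              subst₂ (λ a b → 4# * a ≺ ε * b) (sym (set-≢ (size g) j x k ne)) (sym (set-≢ (size g) j x q (active⇒≢j eq))) lt

    done-inv-j : ∀ i₁ t → σ' j ≡ done i₁ t → DoneInv σ' g' j i₁ t
    done-inv-j i₁ t e with admittedStatus-cases admittedAs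
    ... | inj₂ (_ , aj) = ⊥-elim (active≢done (trans (sym aj) e))
    ... | inj₁ (x0e , dj) with done-injective (trans (sym dj) e)
    ... | refl , refl = record
      { done-size = subst (λ z → p i j ≡ just z) (sym (set-≡ (size g) j x)) pij≡x
      ; done-children = λ c pc → ⊥-elim (j-childless' c pc)
      ; done-surplus-pos = subst (1 ≤ℕ_) (sym (set-≡ (surplus g) j 1)) ℕP.≤-refl
      ; done-surplus = λ mm h → ⊥-elim (h (subst₂ _≤_ (sym (set-≡ (volume g) j 0#)) (sym (trans (cong (θ mm *_) (trans (set-≡ (size g) j x) x0e)) (zeroʳ (θ mm)))) ≤-refl))
      ; done-onTime = λ _ → trans (set-≡ (surplus g) j 1) (cong suc (sym childSurplus'-j≡0))
      ; done-late = λ nle → ⊥-elim (nle τ≤d)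
      ; done-parent = λ q pq → dpar q (trans (sym (set-≡ (parent g) j preempted)) pq)
      }
      where
      τ≤d : τ ≤ d j
      τ≤d with ≺-or-≥ (d j − τ) 0#
      ... | inj₂ nn = 0≤−⇒≤ nn
      ... | inj₁ neg = ⊥-elim (2*-neg neg (subst (_≤ 2# * (d j − τ)) (trans (cong ((2# + ε) *_) x0e) (zeroʳ _)) admission-slack))
      dpar : ∀ q → preempted ≡ just q → 4# * set (size g) j x j ≤ ε * set (size g) j x q
      dpar q e = subst₂ (λ a b → 4# * a ≤ ε * b) (sym (trans (set-≡ (size g) j x) x0e)) (sym (set-≢ (size g) j x q (preempted≢j q e)))
                   (subst (_≤ ε * size g q) (sym (zeroʳ 4#)) (*-nonneg 0≤ε (size-nonneg (proj₂ (preempted-active q e)))))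

    done-inv-other : ∀ k → k ≢ j → ∀ i₁ t → σ' k ≡ done i₁ t → DoneInv σ' g' k i₁ t
    done-inv-other k ne i₁ t e = record
      { done-size = subst (λ z → p i₁ k ≡ just z) (sym (set-≢ (size g) j x k ne)) (done-size D)
      ; done-children = λ c pc → case-j c (λ eq → ⊥-elim (prk (trans (sym (set-≡ (parent g) j preempted)) (subst (λ z → set (parent g) j preempted z ≡ just k) eq pc))))
                  (λ c≠ → dch c c≠ (done-children D c (trans (sym (parent'≡parent c c≠)) pc)))
      ; done-surplus-pos = subst (1 ≤ℕ_) (sym (set-≢ (surplus g) j 1 k ne)) (done-surplus-pos D)
      ; done-surplus = subst₂ (λ e v → DoneSurplus e v (set (size g) j x k)) (sym (set-≢ (surplus g) j 1 k ne)) (sym (set-≢ (volume g) j 0# k ne)) (subst (DoneSurplus _ _) (sym (set-≢ (size g) j x k ne)) (done-surplus D))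
      ; done-onTime = λ le → trans (set-≢ (surplus g) j 1 k ne) (trans (done-onTime D le) (cong suc (sym T'k)))
      ; done-late = λ nle → trans (cong suc (set-≢ (surplus g) j 1 k ne)) (trans (done-late D nle) (sym T'k))
      ; done-parent = λ q pq → dpar q (trans (sym (parent'≡parent k ne)) pq)
      }
      where
      open DoneInv
      ek : σ k ≡ done i₁ t
      ek = trans (sym (unchanged k ne)) e
      D = done-inv k i₁ t ek
      prk : preempted ≢ just k
      prk e' with trans (sym ek) (proj₂ (preempted-active k e'))
      ... | ()
      T'k : childSurplus σ' g' k ≡ childSurplus σ g k
      T'k = childSurplus'≡childSurplus k prk
      dch : ∀ c → c ≢ j → (∃ λ i' → ∃ λ t' → σ c ≡ done i' t') → ∃ λ i' → ∃ λ t' → σ' c ≡ done i' t'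
      dch c c≠ (i' , t' , ec) = i' , t' , trans (unchanged c c≠) ec
      dpar : ∀ q → parent g k ≡ just q → 4# * set (size g) j x k ≤ ε * set (size g) j x q
      dpar q pq = subst₂ (λ a b → 4# * a ≤ ε * b) (sym (set-≢ (size g) j x k ne)) (sym (set-≢ (size g) j x q q≠)) (done-parent D q pq)
        where
        q≠ : q ≢ j
        q≠ refl = parent-admitted k j pq σj≡pending

    σ'j-active : ∀ {i₁ r} → σ' j ≡ active i₁ r → i₁ ≡ i × r ≡ x
    σ'j-active e with admittedStatus-cases admittedAs
    ... | inj₁ (_ , dj) = ⊥-elim (done≢active (trans (sym dj) e))
    ... | inj₂ (_ , aj) with active-injective (trans (sym aj) e)
    ... | refl , refl = refl , refl

    sizes-distinct' : ∀ j₁ k₁ i₁ r r' → σ' j₁ ≡ active i₁ r → σ' k₁ ≡ active i₁ r' → set (size g) j x j₁ ≡ set (size g) j x k₁ → j₁ ≡ k₁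
    sizes-distinct' j₁ k₁ i₁ r r' e1 e2 xe with j₁ Fin.≟ j | k₁ Fin.≟ j
    ... | yes refl | yes refl = refl
    ... | yes refl | no ne2 with σ'j-active e1
    ...   | refl , refl = ⊥-elim (x≺active-sizes k₁ r' (trans (sym (unchanged k₁ ne2)) e2) (≤-reflexive (sym xe)))
    sizes-distinct' j₁ k₁ i₁ r r' e1 e2 xe | no ne1 | yes refl with σ'j-active e2
    ...   | refl , refl = ⊥-elim (x≺active-sizes j₁ r (trans (sym (unchanged j₁ ne1)) e1) (≤-reflexive xe))
    sizes-distinct' j₁ k₁ i₁ r r' e1 e2 xe | no ne1 | no ne2 = sizes-distinct j₁ k₁ i₁ r r' (trans (sym (unchanged j₁ ne1)) e1) (trans (sym (unchanged k₁ ne2)) e2) xe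

    larger-has-child' : ∀ j₁ k₁ i₁ r r' → σ' j₁ ≡ active i₁ r → σ' k₁ ≡ active i₁ r' → set (size g) j x k₁ ≺ set (size g) j x j₁ →
          ∃ λ c → ∃ λ rc → set (parent g) j preempted c ≡ just j₁ × σ' c ≡ active i₁ rc × set (size g) j x k₁ ≤ set (size g) j x c
    larger-has-child' j₁ k₁ i₁ r r' e1 e2 lt with j₁ Fin.≟ j | k₁ Fin.≟ j
    ... | yes refl | yes refl = ⊥-elim (≺-irrefl lt)
    ... | yes refl | no ne2 with σ'j-active e1
    ...   | refl , refl = ⊥-elim (x≺active-sizes k₁ r' (trans (sym (unchanged k₁ ne2)) e2) (≺⇒≤ lt))
    larger-has-child' j₁ k₁ i₁ r r' e1 e2 lt | no ne1 | no ne2 with larger-has-child j₁ k₁ i₁ r r' (trans (sym (unchanged j₁ ne1)) e1) (trans (sym (unchanged k₁ ne2)) e2) lt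
    ... | c , rc , pc , ec , le = c , rc , trans (parent'≡parent c (active⇒≢j ec)) pc , trans (unchanged c (active⇒≢j ec)) ec ,
                                   subst (size g k₁ ≤_) (sym (set-≢ (size g) j x c (active⇒≢j ec))) le
    larger-has-child' j₁ k₁ i₁ r r' e1 e2 lt | no ne1 | yes refl with σ'j-active e2
    ... | refl , refl = go (preempts-view preempted preempts)
      where
      e1' : σ j₁ ≡ active i r
      e1' = trans (sym (unchanged j₁ ne1)) e1
      go : (preempted ≡ nothing × Idle (τ , σ) i) ⊎ (∃ λ c → preempted ≡ just c × Current (τ , σ) i c (size g c) × 4# * r' ≺ ε * size g c) →
           ∃ λ c → ∃ λ rc → set (parent g) j preempted c ≡ just j₁ × σ' c ≡ active i rc × r' ≤ set (size g) j r' c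
      go (inj₁ (_ , idle)) = ⊥-elim (idle j₁ (r , e1'))
      go (inj₂ (c₀ , prc , cur , lt0)) with j₁ Fin.≟ c₀
      ... | yes refl = j , r' , trans (set-≡ (parent g) j preempted) prc , e2 , ≤-reflexive (sym (set-≡ (size g) j r'))
      ... | no nec with larger-has-child j₁ c₀ i r (proj₁ (proj₁ cur)) e1' (proj₂ (proj₁ cur))
                          (≤∧≢⇒≺ (current-minimal cur e1') (λ xe → nec (sym (sizes-distinct c₀ j₁ i (proj₁ (proj₁ cur)) r (proj₂ (proj₁ cur)) e1' xe))))
      ...   | c , rc , pc , ec , le = c , rc , trans (parent'≡parent c (active⇒≢j ec)) pc , trans (unchanged c (active⇒≢j ec)) ec ,
                                       subst (r' ≤_) (sym (set-≢ (size g) j r' c (active⇒≢j ec))) (≺⇒≤ (x≺active-sizes c rc ec))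

    active-child-unique' : ∀ c c' q i₁ i₂ r r' → set (parent g) j preempted c ≡ just q → set (parent g) j preempted c' ≡ just q → σ' c ≡ active i₁ r → σ' c' ≡ active i₂ r' → c ≡ c'
    active-child-unique' c c' q i₁ i₂ r r' pc pc' ec ec' with c Fin.≟ j | c' Fin.≟ j
    ... | yes refl | yes refl = refl
    ... | yes refl | no ne2 = ⊥-elim (current-noActiveChild (proj₁ (preempted-current q pc)) c' i₂ r' pc' (trans (sym (unchanged c' ne2)) ec'))
    ... | no ne1 | yes refl = ⊥-elim (current-noActiveChild (proj₁ (preempted-current q pc')) c i₁ r pc (trans (sym (unchanged c ne1)) ec))
    ... | no ne1 | no ne2 = active-child-unique c c' q i₁ i₂ r r' pc pc' (trans (sym (unchanged c ne1)) ec) (trans (sym (unchanged c' ne2)) ec')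

    pending-orphan' : ∀ k → σ' k ≡ pending → set (parent g) j preempted k ≡ nothing
    pending-orphan' k e with k Fin.≟ j
    ... | yes refl = ⊥-elim (σ'j≢pending e)
    ... | no ne = pending-orphan k (trans (sym (unchanged k ne)) e)

    parent-admitted' : ∀ c q → set (parent g) j preempted c ≡ just q → σ' q ≢ pending
    parent-admitted' c q pc with c Fin.≟ j
    ... | yes refl = admitted-stays q (λ e → active≢pending (trans (sym (proj₂ (preempted-active q pc))) e))
    ... | no ne = admitted-stays q (parent-admitted c q pc)

    active-inv' : ∀ k i₁ r → σ' k ≡ active i₁ r → ActiveInv τ σ' g' k i₁ r
    active-inv' k i₁ r e with k Fin.≟ j
    ... | yes refl = active-inv-j i₁ r e
    ... | no ne = active-inv-other k ne i₁ r e

    done-inv' : ∀ k i₁ t → σ' k ≡ done i₁ t → DoneInv σ' g' k i₁ t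
    done-inv' k i₁ t e with k Fin.≟ j
    ... | yes refl = done-inv-j i₁ t e
    ... | no ne = done-inv-other k ne i₁ t e

    inv' : Inv τ σ' g'
    inv' = record { pending-orphan = pending-orphan' ; parent-admitted = parent-admitted' ; active-inv = active-inv' ; done-inv = done-inv' ; sizes-distinct = sizes-distinct' ; larger-has-child = larger-has-child' ; active-child-unique = active-child-unique' }

  admitStep-preserves : ∀ {τ σ s'} g → Inv τ σ g → AdmitStep (τ , σ) s' → ∃ λ g' → Inv (proj₁ s') (proj₂ s') g'
  admitStep-preserves {τ} {σ} g inv (admit {σ' = σ'} i j x (x' , (av' , _) , idc) _ pij≡x admittedAs unchanged) =
    AdmitPreserves.g' inv i j x (proj₁ preempted-job) (proj₂ preempted-job) avail admittedAs unchanged , AdmitPreserves.inv' inv i j x (proj₁ preempted-job) (proj₂ preempted-job) avail admittedAs unchanged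
    where
    open InvFacts inv
    x'≡x : x' ≡ x
    x'≡x = MaybeP.just-injective (trans (sym (proj₁ (proj₂ (proj₂ av')))) pij≡x)
    avail : Available (τ , σ) i j x
    avail = subst (Available (τ , σ) i j) x'≡x av'
    preemption : (Idle (τ , σ) i ⊎ ∃ λ c → ∃ λ y → Current (τ , σ) i c y × 4# * x' < ε * y) → Σ (Maybe (Fin n)) (Preempts τ σ g i x)
    preemption (inj₁ idle) = nothing , idle
    preemption (inj₂ (c , y , cur , lt)) with current-size cur
    ... | refl = just c , cur , subst (λ z → 4# * z ≺ ε * y) x'≡x (<⇒≺ lt)
    preempted-job = preemption idc

  if-yes : ∀ {P : Set} {a b : ℕ} (q : Dec P) → P → (if does q then a else b) ≡ a
  if-yes (yes _) _ = refl
  if-yes (no np) p = ⊥-elim (np p)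
  if-no : ∀ {P : Set} {a b : ℕ} (q : Dec P) → ¬ P → (if does q then a else b) ≡ b
  if-no (yes p) np = ⊥-elim (np p)
  if-no (no _) _ = refl

  2≤⇒suc-pred : ∀ {T} → 2 ≤ℕ T → suc (ℕ.pred T) ≡ T
  2≤⇒suc-pred (ℕ.s≤s (ℕ.s≤s _)) = refl

  -- Completing after d exhausts the admission slack, so the waiting time U
  -- must exceed ε X / 2.
  late⇒large-childVolume : ∀ {X U dd τ r τ'} → (2# + ε) * X ≤ 2# * (dd − τ + X − r + U) → τ + r ≡ τ' → dd ≺ τ' → θ 1 * (ε * X) ≺ 4# * U
  late⇒large-childVolume {X} {U} {dd} {τ} {r} {τ'} H refl lt = subst₂ _≺_ (e3 (ε * X)) (e4 U) (+-mono-≺-≤ εX≺2U (≺⇒≤ εX≺2U))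
    where
    D≺0 : dd − (τ + r) ≺ 0#
    D≺0 = subst (dd − (τ + r) ≺_) (-‿inverseʳ (τ + r)) (+-mono-≺-≤ lt ≤-refl)
    e1 : 2# * (dd − τ + X − r + U) ≡ 2# * (dd − (τ + r)) + (2# * X + 2# * U)
    e1 = solve 5 (λ dd τ X r U → (:2 :* (dd :- τ :+ X :- r :+ U)) := (:2 :* (dd :- (τ :+ r)) :+ (:2 :* X :+ :2 :* U))) refl dd τ X r U
    h1 : (2# + ε) * X ≺ 0# + (2# * X + 2# * U)
    h1 = ≤-≺-trans H (subst (_≺ 0# + (2# * X + 2# * U)) (sym e1) (+-mono-≺-≤ (2*-neg D≺0) ≤-refl))
    e2 : (2# + ε) * X ≡ 2# * X + ε * X
    e2 = solve 2 (λ e X → ((:2 :+ e) :* X) := (:2 :* X :+ e :* X)) refl ε X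
    εX≺2U : ε * X ≺ 2# * U
    εX≺2U q = h1 (subst₂ _≤_ (sym (+-identityˡ _)) (sym e2) (+-monoʳ-≤ (2# * X) q))
    e3 : ∀ a → a + a ≡ θ 1 * a
    e3 = solve 1 (λ a → (a :+ a) := (:2 :* a)) refl
    e4 : ∀ U → 2# * U + 2# * U ≡ 4# * U
    e4 = solve 1 (λ U → (:2 :* U :+ :2 :* U) := (:4 :* U)) refl

  module AdvancePreserves {τ τ' : R} {σ σ' : Fin n → JobStatus} {g : Ghost} (inv : Inv τ σ g)
                  (proc : Fin m → Maybe (Fin n)) (procH : Processing (τ , σ) proc)
                  (ev : ∀ k → Evolve τ τ' proc k (σ k) (σ' k)) where
    open Inv inv
    open InvFacts inv

    Δ : R
    Δ = τ' − τ

    data View (k : Fin n) : Set where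
      stays-pending : σ k ≡ pending → σ' k ≡ pending → View k
      stays-done : ∀ i t → σ k ≡ done i t → σ' k ≡ done i t → View k
      waits : ∀ i r → σ k ≡ active i r → σ' k ≡ active i r → proc i ≢ just k → View k
      finishes : ∀ i r → σ k ≡ active i r → σ' k ≡ done i τ' → proc i ≡ just k → τ + r ≡ τ' → View k
      runs : ∀ i r → σ k ≡ active i r → σ' k ≡ active i (r − (τ' − τ)) → proc i ≡ just k → View k

    view-of : ∀ {k s s'} → Evolve τ τ' proc k s s' → s ≡ σ k → s' ≡ σ' k → View k
    view-of ev-pending e e' = stays-pending (sym e) (sym e')
    view-of (ev-done i t) e e' = stays-done i t (sym e) (sym e')
    view-of (ev-wait i rem x) e e' = waits i rem (sym e) (sym e') x
    view-of (ev-finish i rem x x₁) e e' = finishes i rem (sym e) (sym e') x x₁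
    view-of (ev-run i rem x x₁) e e' = runs i rem (sym e) (sym e') x

    view : ∀ k → View k
    view k = view-of (ev k) refl refl

    T = childSurplus σ g
    U = childVolume σ g

    blocked' : Fin n → JobStatus → R
    blocked' k (active i r) = if does (MaybeP.≡-dec Fin._≟_ (proc i) (just k)) then blocked g k else blocked g k + Δ
    blocked' k _ = blocked g k

    -- ℕ.pred does not truncate here: a late job has childSurplus ≥ 2.
    surplus' : Fin n → JobStatus → JobStatus → ℕ
    surplus' k (active _ _) (done _ t) = if does (t ≤? d k) then suc (T k) else ℕ.pred (T k)
    surplus' k _ _ = surplus g k

    volume' : Fin n → JobStatus → JobStatus → R
    volume' k (active _ _) (done _ t) = size g k + U k
    volume' k _ _ = volume g k

    g' : Ghost
    g' = ghost (parent g) (size g) (λ k → blocked' k (σ k)) (λ k → volume' k (σ k) (σ' k)) (λ k → surplus' k (σ k) (σ' k))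

    T' = childSurplus σ' g'
    U' = childVolume σ' g'
    N' = Ghost.surplus g'
    V' = Ghost.volume g'
    B' = Ghost.blocked g'

    blocked'-waits : ∀ {k i r} → σ k ≡ active i r → proc i ≢ just k → B' k ≡ blocked g k + Δ
    blocked'-waits {k} {i} {r} e ne rewrite e with MaybeP.≡-dec Fin._≟_ (proc i) (just k)
    ... | yes p = ⊥-elim (ne p)
    ... | no _ = refl
    blocked'-runs : ∀ {k i r} → σ k ≡ active i r → proc i ≡ just k → B' k ≡ blocked g k
    blocked'-runs {k} {i} {r} e pk rewrite e with MaybeP.≡-dec Fin._≟_ (proc i) (just k)
    ... | yes _ = refl
    ... | no ne = ⊥-elim (ne pk)

    NotFinishing : Fin n → Set
    NotFinishing c = ∀ i r i' t → σ c ≡ active i r → σ' c ≡ done i' t → ⊥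

    surplus-volume-kept : ∀ k → NotFinishing k → N' k ≡ surplus g k × V' k ≡ volume g k
    surplus-volume-kept k nf with view k
    ... | stays-pending e e' rewrite e | e' = refl , refl
    ... | stays-done i t e e' rewrite e | e' = refl , refl
    ... | waits i r e e' _ rewrite e | e' = refl , refl
    ... | runs i r e e' _ rewrite e | e' = refl , refl
    ... | finishes i r e e' _ _ = ⊥-elim (nf i r i τ' e e')

    surplus-volume-finished : ∀ {k i r i' t} → σ k ≡ active i r → σ' k ≡ done i' t →
            N' k ≡ (if does (t ≤? d k) then suc (T k) else ℕ.pred (T k)) × V' k ≡ size g k + U k
    surplus-volume-finished e e' rewrite e | e' = refl , refl

    contributionℕ-kept : ∀ j c → NotFinishing c → contributionℕ (parent g c) j (σ' c) (N' c) ≡ contributionℕ (parent g c) j (σ c) (surplus g c)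
    contributionℕ-kept j c nf with view c
    ... | stays-pending e e' rewrite e | e' = refl
    ... | stays-done i t e e' = cong₂ (contributionℕ (parent g c) j) (trans e' (sym e)) (proj₁ (surplus-volume-kept c nf))
    ... | waits i r e e' _ rewrite e | e' = refl
    ... | runs i r e e' _ rewrite e | e' = refl
    ... | finishes i r e e' _ _ = ⊥-elim (nf i r i τ' e e')

    contribution-kept : ∀ j c → NotFinishing c → contribution (parent g c) j (σ' c) (V' c) ≡ contribution (parent g c) j (σ c) (volume g c)
    contribution-kept j c nf with view c
    ... | stays-pending e e' rewrite e | e' = refl
    ... | stays-done i t e e' = cong₂ (contribution (parent g c) j) (trans e' (sym e)) (proj₂ (surplus-volume-kept c nf))
    ... | waits i r e e' _ rewrite e | e' = refl
    ... | runs i r e e' _ rewrite e | e' = refl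
    ... | finishes i r e e' _ _ = ⊥-elim (nf i r i τ' e e')

    contributionℕ-kept-for : ∀ j c → (parent g c ≡ just j → NotFinishing c) → contributionℕ (parent g c) j (σ' c) (N' c) ≡ contributionℕ (parent g c) j (σ c) (surplus g c)
    contributionℕ-kept-for j c h with MaybeP.≡-dec Fin._≟_ (parent g c) (just j)
    ... | yes pc = contributionℕ-kept j c (h pc)
    ... | no ne = trans (contributionℕ-other j (σ' c) (N' c) ne) (sym (contributionℕ-other j (σ c) (surplus g c) ne))
    contribution-kept-for : ∀ j c → (parent g c ≡ just j → NotFinishing c) → contribution (parent g c) j (σ' c) (V' c) ≡ contribution (parent g c) j (σ c) (volume g c)
    contribution-kept-for j c h with MaybeP.≡-dec Fin._≟_ (parent g c) (just j)
    ... | yes pc = contribution-kept j c (h pc)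
    ... | no ne = trans (contribution-other j (σ' c) (V' c) ne) (sym (contribution-other j (σ c) (volume g c) ne))

    child-sums-kept : ∀ j → (∀ c → parent g c ≡ just j → NotFinishing c) → T' j ≡ T j × U' j ≡ U j
    child-sums-kept j h = ∑ℕ.sum-cong-≗ (λ c → contributionℕ-kept-for j c (h c)) , ∑R.sum-cong-≗ (λ c → contribution-kept-for j c (h c))

    child-sums-one-finished : ∀ j c₀ {i r i' t} → parent g c₀ ≡ just j → σ c₀ ≡ active i r → σ' c₀ ≡ done i' t →
             (∀ c → c ≢ c₀ → parent g c ≡ just j → NotFinishing c) →
             T' j ℕ.+ 0 ≡ T j ℕ.+ N' c₀ × U' j + 0# ≡ U j + V' c₀
    child-sums-one-finished j c₀ {i} {r} {i'} {t} pc e e' h =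
      subst₂ (λ a b → T' j ℕ.+ a ≡ T j ℕ.+ b) o1 n1 (∑ℕ.sum-update c₀ (λ c ne → contributionℕ-kept-for j c (h c ne))) ,
      subst₂ (λ a b → U' j + a ≡ U j + b) o2 n2 (∑R.sum-update c₀ (λ c ne → contribution-kept-for j c (h c ne)))
      where
      o1 : contributionℕ (parent g c₀) j (σ c₀) (surplus g c₀) ≡ 0
      o1 rewrite e = refl
      n1 : contributionℕ (parent g c₀) j (σ' c₀) (N' c₀) ≡ N' c₀
      n1 rewrite pc | e' = contributionℕ-self j (done i' t) (surplus' c₀ (σ c₀) (done i' t))
      o2 : contribution (parent g c₀) j (σ c₀) (volume g c₀) ≡ 0#
      o2 rewrite e = refl
      n2 : contribution (parent g c₀) j (σ' c₀) (V' c₀) ≡ V' c₀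
      n2 rewrite pc | e' = contribution-self j (done i' t) (volume' c₀ (σ c₀) (done i' t))

    processed-current : ∀ {i c} → proc i ≡ just c → Current (τ , σ) i c (size g c)
    processed-current {i} {c} pc with procH i
    ... | inj₁ (pn , _) with trans (sym pn) pc
    ...   | ()
    processed-current {i} {c} pc | inj₂ (c' , pc' , y , cur) with MaybeP.just-injective (trans (sym pc') pc)
    ... | refl with current-size cur
    ...   | refl = cur

    active-before : ∀ {k i r'} → σ' k ≡ active i r' → ∃ λ r → σ k ≡ active i r
    active-before {k} e' with view k
    ... | stays-pending _ e2 with trans (sym e2) e'
    ...   | ()
    active-before {k} e' | stays-done _ _ _ e2 with trans (sym e2) e'
    ...   | ()
    active-before {k} e' | finishes _ _ _ e2 _ _ with trans (sym e2) e'
    ...   | ()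
    active-before {k} e' | waits i r e e2 _ with active-injective (trans (sym e2) e')
    ...   | refl , refl = r , e
    active-before {k} e' | runs i r e e2 _ with active-injective (trans (sym e2) e')
    ...   | refl , refl = r , e

    pending-before : ∀ {k} → σ' k ≡ pending → σ k ≡ pending
    pending-before {k} e' with view k
    ... | stays-pending e _ = e
    ... | stays-done _ _ _ e2 with trans (sym e2) e'
    ...   | ()
    pending-before {k} e' | waits _ _ _ e2 _ with trans (sym e2) e'
    ...   | ()
    pending-before {k} e' | finishes _ _ _ e2 _ _ with trans (sym e2) e'
    ...   | ()
    pending-before {k} e' | runs _ _ _ e2 _ with trans (sym e2) e'
    ...   | ()

    done-after : ∀ {k i t} → σ k ≡ done i t → σ' k ≡ done i t
    done-after {k} e with view k
    ... | stays-done _ _ e1 e2 with done-injective (trans (sym e1) e)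
    ...   | refl , refl = e2
    done-after {k} e | stays-pending e1 _ with trans (sym e1) e
    ...   | ()
    done-after {k} e | waits _ _ e1 _ _ with trans (sym e1) e
    ...   | ()
    done-after {k} e | finishes _ _ e1 _ _ _ with trans (sym e1) e
    ...   | ()
    done-after {k} e | runs _ _ e1 _ _ with trans (sym e1) e
    ...   | ()

    finishing-facts : ∀ {c i r i' t} → σ c ≡ active i r → σ' c ≡ done i' t → proc i ≡ just c × τ + r ≡ τ' × i' ≡ i × t ≡ τ'
    finishing-facts {c} e e' with view c
    ... | finishes i₀ r₀ e1 e2 pc tr with active-injective (trans (sym e1) e) | done-injective (trans (sym e2) e')
    ...   | refl , refl | refl , refl = pc , tr , refl , refl
    finishing-facts {c} e e' | stays-pending e1 _ with trans (sym e1) e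
    ...   | ()
    finishing-facts {c} e e' | stays-done _ _ e1 _ with trans (sym e1) e
    ...   | ()
    finishing-facts {c} e e' | waits _ _ _ e2 _ with trans (sym e2) e'
    ...   | ()
    finishing-facts {c} e e' | runs _ _ _ e2 _ with trans (sym e2) e'
    ...   | ()

    noActiveChild⇒notFinishing : ∀ {j} → NoActiveChild σ g j → ∀ c → parent g c ≡ just j → NotFinishing c
    noActiveChild⇒notFinishing na c pc i r i' t e e' = na c i r pc e

    record FinishedInv (c : Fin n) : Set where
      field
        fin-surplus-pos : 1 ≤ℕ N' c
        fin-surplus : DoneSurplus (N' c) (V' c) (size g c)
        fin-onTime : τ' ≤ d c → N' c ≡ suc (T' c)
        fin-late : ¬ (τ' ≤ d c) → suc (N' c) ≡ T' c
        fin-noActiveChild : NoActiveChild σ g c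

    finished-inv : ∀ {c i r} → σ c ≡ active i r → σ' c ≡ done i τ' → FinishedInv c
    finished-inv {c} {i} {r} ec ec' = record
      { fin-surplus-pos = surplus-pos ; fin-surplus = surplus-bound ; fin-onTime = onTime-eq ; fin-late = late-eq ; fin-noActiveChild = childless }
      where
      info = finishing-facts ec ec'
      cur = processed-current (proj₁ info)
      childless = current-noActiveChild cur
      A = active-inv c i r ec
      -- a processed job has no active child, so it has waited exactly U c
      waited≡U : blocked g c ≡ U c
      waited≡U with ActiveInv.act-blocked A
      ... | inj₁ (_ , b) = b
      ... | inj₂ (c₁ , rc , pc , ec₁ , _) = ⊥-elim (childless c₁ i rc pc ec₁)
      TUs = child-sums-kept c (noActiveChild⇒notFinishing childless)
      0≤size = size-nonneg ec
      surplus-c = ActiveInv.act-surplus A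
      late-volume : ¬ (τ' ≤ d c) → θ 1 * (ε * size g c) ≺ 4# * U c
      late-volume nle = late⇒large-childVolume (subst (λ z → (2# + ε) * size g c ≤ 2# * (d c − τ + size g c − r + z)) waited≡U (ActiveInv.act-slack A)) (proj₁ (proj₂ info)) nle
      nN : N' c ≡ (if does (τ' ≤? d c) then suc (T c) else ℕ.pred (T c))
      nN = proj₁ (surplus-volume-finished ec ec')
      nV : V' c ≡ size g c + U c
      nV = proj₂ (surplus-volume-finished ec ec')
      N'-onTime : τ' ≤ d c → N' c ≡ suc (T c)
      N'-onTime le = trans nN (if-yes (τ' ≤? d c) le)
      N'-late : ¬ (τ' ≤ d c) → N' c ≡ ℕ.pred (T c)
      N'-late nle = trans nN (if-no (τ' ≤? d c) nle)
      onTime-eq : τ' ≤ d c → N' c ≡ suc (T' c)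
      onTime-eq le = trans (N'-onTime le) (cong suc (sym (proj₁ TUs)))
      late-eq : ¬ (τ' ≤ d c) → suc (N' c) ≡ T' c
      late-eq nle = trans (cong suc (N'-late nle)) (trans (2≤⇒suc-pred (surplus-c 1 (late-volume nle))) (sym (proj₁ TUs)))
      surplus-pos : 1 ≤ℕ N' c
      surplus-pos with τ' ≤? d c
      ... | yes le = subst (1 ≤ℕ_) (sym (N'-onTime le)) (ℕ.s≤s ℕ.z≤n)
      ... | no nle = subst (1 ≤ℕ_) (sym (N'-late nle)) (ℕP.pred-mono-≤ (surplus-c 1 (late-volume nle)))
      surplus-bound : DoneSurplus (N' c) (V' c) (size g c)
      surplus-bound mm h with τ' ≤? d c
      ... | yes le = subst (suc mm ≤ℕ_) (sym (N'-onTime le)) (activeSurplus⇒doneSurplus-onTime 0≤size surplus-c mm (subst (θ mm * size g c ≺_) nV h))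
      ... | no nle = subst (suc mm ≤ℕ_) (sym (N'-late nle)) (ℕP.pred-mono-≤ (activeSurplus⇒doneSurplus-late 0≤size surplus-c (late-volume nle) mm (subst (θ mm * size g c ≺_) nV h)))

    parent-stays-active : ∀ {k i r q rq} → σ k ≡ active i r → parent g k ≡ just q → σ q ≡ active i rq → ∃ λ rq' → σ' q ≡ active i rq'
    parent-stays-active {k} {i} {r} {q} {rq} ek pk eq with view q
    ... | waits i₀ r₀ e1 e2 _ with active-injective (trans (sym e1) eq)
    ...   | refl , refl = r₀ , e2
    parent-stays-active {k} {i} {r} {q} {rq} ek pk eq | runs i₀ r₀ e1 e2 _ with active-injective (trans (sym e1) eq)
    ...   | refl , refl = _ , e2
    parent-stays-active {k} {i} {r} {q} {rq} ek pk eq | finishes i₀ r₀ e1 e2 pq _ with active-injective (trans (sym e1) eq)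
    ...   | refl , refl = ⊥-elim (current-noActiveChild (processed-current pq) k i r pk ek)
    parent-stays-active {k} {i} {r} {q} {rq} ek pk eq | stays-pending e1 _ with trans (sym e1) eq
    ...   | ()
    parent-stays-active {k} {i} {r} {q} {rq} ek pk eq | stays-done _ _ e1 _ with trans (sym e1) eq
    ...   | ()

    act-parent' : ∀ {k i r} → σ k ≡ active i r → ∀ q → parent g k ≡ just q → (∃ λ rq → σ' q ≡ active i rq) × (4# * size g k ≺ ε * size g q)
    act-parent' {k} {i} {r} ek q pq with ActiveInv.act-parent (active-inv k i r ek) q pq
    ... | (rq , eq) , lt = parent-stays-active ek pq eq , lt

    blocked≡childVolume : ∀ {c i r} → σ c ≡ active i r → NoActiveChild σ g c → blocked g c ≡ U c
    blocked≡childVolume {c} {i} {r} ec na with ActiveInv.act-blocked (active-inv c i r ec)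
    ... | inj₁ (_ , b) = b
    ... | inj₂ (c₁ , rc , pc , ec₁ , _) = ⊥-elim (na c₁ i rc pc ec₁)

    active-inv-runs : ∀ k i r → σ k ≡ active i r → proc i ≡ just k → ActiveInv τ' σ' g' k i (r − Δ)
    active-inv-runs k i r e pk = record
      { act-size = ActiveInv.act-size A
      ; act-slack = subst (λ z → (2# + ε) * size g k ≤ 2# * z) (eqH (d k) (size g k) (B' k)) (subst (λ z → (2# + ε) * size g k ≤ 2# * (d k − τ + size g k − r + z)) (sym (blocked'-runs e pk)) (ActiveInv.act-slack A))
      ; act-blocked = inj₁ ((λ c i' rc pc ec' → noact c _ _ pc (proj₂ (active-before ec'))) , trans (blocked'-runs e pk) (trans (blocked≡childVolume e noact) (sym (proj₂ TUs))))
      ; act-surplus = subst₂ (λ a b → ActiveSurplus a b (size g k)) (sym (proj₁ TUs)) (sym (proj₂ TUs)) (ActiveInv.act-surplus A)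
      ; act-parent = act-parent' e
      }
      where
      A = active-inv k i r e
      noact = current-noActiveChild (processed-current pk)
      TUs = child-sums-kept k (noActiveChild⇒notFinishing noact)
      eqH : ∀ dd x b → dd − τ + x − r + b ≡ dd − τ' + x − (r − (τ' − τ)) + b
      eqH dd x b = solve 6 (λ dd x b t t' r → (dd :- t :+ x :- r :+ b) := (dd :- t' :+ x :- (r :- (t' :- t)) :+ b)) refl dd x b τ τ' r

    only-child-notFinishing : ∀ {k c₁ i rc} → parent g c₁ ≡ just k → σ c₁ ≡ active i rc → (∀ i' t → σ' c₁ ≢ done i' t) → ∀ c → parent g c ≡ just k → NotFinishing c
    only-child-notFinishing {k} {c₁} pc₁ ec₁ nd c pc i r i' t ec ec' with active-child-unique c c₁ k i _ r _ pc pc₁ ec ec₁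
    ... | refl = nd i' t ec'

    siblings-notFinishing : ∀ {k c₁ i rc} → parent g c₁ ≡ just k → σ c₁ ≡ active i rc → ∀ c → c ≢ c₁ → parent g c ≡ just k → NotFinishing c
    siblings-notFinishing {k} {c₁} pc₁ ec₁ c ne pc i r i' t ec ec' = ne (active-child-unique c c₁ k i _ r _ pc pc₁ ec ec₁)

    -- k waits because a job smaller than k runs on its machine, and the
    -- chain of interruptions leading to it starts with an active child of k.
    waiting⇒active-child : ∀ {k i r} → σ k ≡ active i r → proc i ≢ just k →
                           ∃ λ c → ∃ λ rc → parent g c ≡ just k × σ c ≡ active i rc
    waiting⇒active-child {k} {i} {r} e npk with procH i
    ... | inj₁ (_ , idle) = ⊥-elim (idle k (r , e))
    ... | inj₂ (c₀ , pc₀ , _) with processed-current pc₀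
    ...   | cur with larger-has-child k c₀ i r _ e (proj₂ (proj₁ cur))
                       (≤∧≢⇒≺ (current-minimal cur e)
                              (λ xe → npk (subst (λ z → proc i ≡ just z) (sizes-distinct c₀ k i _ r (proj₂ (proj₁ cur)) e xe) pc₀)))
    ...     | c , rc , pc , ec , _ = c , rc , pc , ec

    child-waits : ∀ {k i r c₁ rc} → σ k ≡ active i r → proc i ≢ just k →
                  parent g c₁ ≡ just k → σ c₁ ≡ active i rc → σ' c₁ ≡ active i rc → proc i ≢ just c₁ →
                  blocked g k ≡ U k + (size g c₁ − rc + blocked g c₁) →
                  BlockedInv σ' g' k i × ActiveSurplus (T' k) (U' k) (size g k)
    child-waits {k} {i} {r} {c₁} {rc} e npk pc₁ ec₁ ec₁' np1 beq =
      inj₂ (c₁ , rc , pc₁ , ec₁' , eqB) ,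
      subst₂ (λ a b → ActiveSurplus a b (size g k)) (sym (proj₁ TUs)) (sym (proj₂ TUs)) (ActiveInv.act-surplus (active-inv k i r e))
      where
      TUs = child-sums-kept k (only-child-notFinishing pc₁ ec₁ (λ i'' t e2 → active≢done (trans (sym ec₁') e2)))
      eqB : B' k ≡ U' k + (size g c₁ − rc + B' c₁)
      eqB = trans (blocked'-waits e npk) (trans (cong (_+ Δ) beq) (trans
              (solve 5 (λ u x rc b dl → u :+ (x :- rc :+ b) :+ dl := u :+ (x :- rc :+ (b :+ dl))) refl (U k) (size g c₁) rc (blocked g c₁) Δ)
              (cong₂ (λ a b → a + (size g c₁ − rc + b)) (sym (proj₂ TUs)) (sym (blocked'-waits ec₁ np1)))))

    child-runs : ∀ {k i r c₁ rc} → σ k ≡ active i r → proc i ≢ just k →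
                 parent g c₁ ≡ just k → σ c₁ ≡ active i rc → σ' c₁ ≡ active i (rc − Δ) → proc i ≡ just c₁ →
                 blocked g k ≡ U k + (size g c₁ − rc + blocked g c₁) →
                 BlockedInv σ' g' k i × ActiveSurplus (T' k) (U' k) (size g k)
    child-runs {k} {i} {r} {c₁} {rc} e npk pc₁ ec₁ ec₁' pc1 beq =
      inj₂ (c₁ , rc − Δ , pc₁ , ec₁' , eqB) ,
      subst₂ (λ a b → ActiveSurplus a b (size g k)) (sym (proj₁ TUs)) (sym (proj₂ TUs)) (ActiveInv.act-surplus (active-inv k i r e))
      where
      TUs = child-sums-kept k (only-child-notFinishing pc₁ ec₁ (λ i'' t e2 → active≢done (trans (sym ec₁') e2)))
      eqB : B' k ≡ U' k + (size g c₁ − (rc − Δ) + B' c₁)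
      eqB = trans (blocked'-waits e npk) (trans (cong (_+ Δ) beq) (trans
              (solve 5 (λ u x rc b dl → u :+ (x :- rc :+ b) :+ dl := u :+ (x :- (rc :- dl) :+ b)) refl (U k) (size g c₁) rc (blocked g c₁) Δ)
              (cong₂ (λ a b → a + (size g c₁ − (rc − Δ) + b)) (sym (proj₂ TUs)) (sym (blocked'-runs ec₁ pc1)))))

    -- The finished child's volume moves from blocked time into U, and its
    -- surplus is merged into that of k.
    child-finishes : ∀ {k i r c₁ rc} → σ k ≡ active i r → proc i ≢ just k →
                     parent g c₁ ≡ just k → σ c₁ ≡ active i rc → σ' c₁ ≡ done i τ' → τ + rc ≡ τ' →
                     blocked g k ≡ U k + (size g c₁ − rc + blocked g c₁) →
                     BlockedInv σ' g' k i × ActiveSurplus (T' k) (U' k) (size g k)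
    child-finishes {k} {i} {r} {c₁} {rc} e npk pc₁ ec₁ ec₁' tr beq = inj₁ (na' , eqB) , gd
      where
      ff = finished-inv ec₁ ec₁'
      TUo = child-sums-one-finished k c₁ pc₁ ec₁ ec₁' (siblings-notFinishing pc₁ ec₁)
      buc : blocked g c₁ ≡ U c₁
      buc = blocked≡childVolume ec₁ (FinishedInv.fin-noActiveChild ff)
      na' : NoActiveChild σ' g' k
      na' c i'' rc' pc ec' with active-before ec'
      ... | rr , ecc with active-child-unique c c₁ k i'' i rr rc pc pc₁ ecc ec₁
      ...   | refl = done≢active (trans (sym ec₁') ec')
      U'k : U' k ≡ U k + (size g c₁ + U c₁)
      U'k = trans (sym (+-identityʳ _)) (trans (proj₂ TUo) (cong (U k +_) (proj₂ (surplus-volume-finished ec₁ ec₁'))))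
      eqB : B' k ≡ U' k
      eqB = trans (blocked'-waits e npk) (trans (cong (_+ Δ) beq)
              (trans (cong₂ (λ b t → U k + (size g c₁ − rc + b) + (t − τ)) buc (sym tr))
              (trans (solve 5 (λ u x rc b t → u :+ (x :- rc :+ b) :+ (t :+ rc :- t) := u :+ (x :+ b)) refl (U k) (size g c₁) rc (U c₁) τ)
              (sym U'k))))
      4c₁≤εk : 4# * size g c₁ ≤ ε * size g k
      4c₁≤εk = ≺⇒≤ (proj₂ (ActiveInv.act-parent (active-inv c₁ i rc ec₁) k pc₁))
      gd : ActiveSurplus (T' k) (U' k) (size g k)
      gd = subst₂ (λ a b → ActiveSurplus a b (size g k))
             (trans (sym (proj₁ TUo)) (ℕP.+-identityʳ _))
             (trans (sym (proj₂ TUo)) (+-identityʳ _))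
             (activeSurplus-+ (size-nonneg e) (ActiveInv.act-surplus (active-inv k i r e))
               (doneSurplus⇒activeSurplus (size-nonneg ec₁) (FinishedInv.fin-surplus ff) 4c₁≤εk)
               (FinishedInv.fin-surplus-pos ff))

    active-inv-waits : ∀ k i r → σ k ≡ active i r → proc i ≢ just k → ActiveInv τ' σ' g' k i r
    active-inv-waits k i r e npk = record
      { act-size = ActiveInv.act-size A
      ; act-slack = subst (λ z → (2# + ε) * size g k ≤ 2# * z) slack-eq (ActiveInv.act-slack A)
      ; act-blocked = proj₁ blocked-surplus
      ; act-surplus = proj₂ blocked-surplus
      ; act-parent = act-parent' e
      }
      where
      A = active-inv k i r e
      slack-eq : d k − τ + size g k − r + blocked g k ≡ d k − τ' + size g k − r + B' k
      slack-eq = trans (solve 6 (λ dd x b t t' r → dd :- t :+ x :- r :+ b := dd :- t' :+ x :- r :+ (b :+ (t' :- t))) refl (d k) (size g k) (blocked g k) τ τ' r)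
                       (cong (λ z → d k − τ' + size g k − r + z) (sym (blocked'-waits e npk)))
      blocked-surplus : BlockedInv σ' g' k i × ActiveSurplus (T' k) (U' k) (size g k)
      blocked-surplus with ActiveInv.act-blocked A
      ... | inj₁ (na , _) with waiting⇒active-child e npk
      ...   | c , rc , pc , ec = ⊥-elim (na c i rc pc ec)
      blocked-surplus | inj₂ (c₁ , rc , pc₁ , ec₁ , beq) with view c₁
      ... | stays-pending e1 _ = ⊥-elim (active≢pending (trans (sym ec₁) e1))
      ... | stays-done _ _ e1 _ = ⊥-elim (active≢done (trans (sym ec₁) e1))
      ... | waits _ _ e1 e1' np1 with active-injective (trans (sym e1) ec₁)
      ...   | refl , refl = child-waits e npk pc₁ ec₁ e1' np1 beq
      blocked-surplus | inj₂ (c₁ , rc , pc₁ , ec₁ , beq) | runs _ _ e1 e1' pc1 with active-injective (trans (sym e1) ec₁)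
      ...   | refl , refl = child-runs e npk pc₁ ec₁ e1' pc1 beq
      blocked-surplus | inj₂ (c₁ , rc , pc₁ , ec₁ , beq) | finishes _ _ e1 e1' _ tr with active-injective (trans (sym e1) ec₁)
      ...   | refl , refl = child-finishes e npk pc₁ ec₁ e1' tr beq

    active-inv' : ∀ k i₁ r' → σ' k ≡ active i₁ r' → ActiveInv τ' σ' g' k i₁ r'
    active-inv' k i₁ r' e' with view k
    ... | waits i r e e2 np with active-injective (trans (sym e2) e')
    ...   | refl , refl = active-inv-waits k i r e np
    active-inv' k i₁ r' e' | runs i r e e2 pk with active-injective (trans (sym e2) e')
    ...   | refl , refl = active-inv-runs k i r e pk
    active-inv' k i₁ r' e' | stays-pending _ e2 with trans (sym e2) e'
    ...   | ()
    active-inv' k i₁ r' e' | stays-done _ _ _ e2 with trans (sym e2) e'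
    ...   | ()
    active-inv' k i₁ r' e' | finishes _ _ _ e2 _ _ with trans (sym e2) e'
    ...   | ()

    done-inv-stays : ∀ {k i t} → σ k ≡ done i t → DoneInv σ' g' k i t
    done-inv-stays {k} {i} {t} e = record
      { done-size = DoneInv.done-size D
      ; done-children = λ c pc → children-done c (DoneInv.done-children D c pc)
      ; done-surplus-pos = subst (1 ≤ℕ_) (sym (proj₁ kept)) (DoneInv.done-surplus-pos D)
      ; done-surplus = subst₂ (λ a b → DoneSurplus a b (size g k)) (sym (proj₁ kept)) (sym (proj₂ kept)) (DoneInv.done-surplus D)
      ; done-onTime = λ le → trans (proj₁ kept) (trans (DoneInv.done-onTime D le) (cong suc (sym (proj₁ TUs))))
      ; done-late = λ nle → trans (cong suc (proj₁ kept)) (trans (DoneInv.done-late D nle) (sym (proj₁ TUs)))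
      ; done-parent = DoneInv.done-parent D
      }
      where
      D = done-inv k i t e
      children-done : ∀ c → (∃ λ i' → ∃ λ t' → σ c ≡ done i' t') → ∃ λ i' → ∃ λ t' → σ' c ≡ done i' t'
      children-done c (i' , t' , ec) = i' , t' , done-after ec
      kept = surplus-volume-kept k (λ i r i' t ek _ → done≢active (trans (sym e) ek))
      TUs = child-sums-kept k (λ c pc i r i' t ec _ → done≢active (trans (sym (proj₂ (proj₂ (DoneInv.done-children D c pc)))) ec))

    done-inv-finishes : ∀ {k i r} → σ k ≡ active i r → σ' k ≡ done i τ' → DoneInv σ' g' k i τ'
    done-inv-finishes {k} {i} {r} e e' = record
      { done-size = ActiveInv.act-size A
      ; done-children = children-done
      ; done-surplus-pos = FinishedInv.fin-surplus-pos ff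
      ; done-surplus = FinishedInv.fin-surplus ff
      ; done-onTime = FinishedInv.fin-onTime ff
      ; done-late = FinishedInv.fin-late ff
      ; done-parent = λ q pq → ≺⇒≤ (proj₂ (ActiveInv.act-parent A q pq))
      }
      where
      A = active-inv k i r e
      ff = finished-inv e e'
      children-done : ∀ c → parent g c ≡ just k → ∃ λ i' → ∃ λ t' → σ' c ≡ done i' t'
      children-done c pc with σ c in ec
      ... | pending with trans (sym (pending-orphan c ec)) pc
      ...   | ()
      children-done c pc | active i' rc = ⊥-elim (FinishedInv.fin-noActiveChild ff c i' rc pc ec)
      children-done c pc | done i' t' = i' , t' , done-after ec

    done-inv' : ∀ k i₁ t → σ' k ≡ done i₁ t → DoneInv σ' g' k i₁ t
    done-inv' k i₁ t e' with view k
    ... | stays-done i t₀ e e2 with done-injective (trans (sym e2) e')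
    ...   | refl , refl = done-inv-stays e
    done-inv' k i₁ t e' | finishes i r e e2 _ _ with done-injective (trans (sym e2) e')
    ...   | refl , refl = done-inv-finishes e e2
    done-inv' k i₁ t e' | stays-pending _ e2 = ⊥-elim (pending≢done (trans (sym e2) e'))
    done-inv' k i₁ t e' | waits _ _ _ e2 _ = ⊥-elim (active≢done (trans (sym e2) e'))
    done-inv' k i₁ t e' | runs _ _ _ e2 _ = ⊥-elim (active≢done (trans (sym e2) e'))

    larger-has-child' : ∀ j k i r r' → σ' j ≡ active i r → σ' k ≡ active i r' → size g k ≺ size g j →
          ∃ λ c → ∃ λ rc → parent g c ≡ just j × σ' c ≡ active i rc × size g k ≤ size g c
    larger-has-child' j k i r r' e1 e2 lt with active-before e1 | active-before e2
    ... | r₁ , o1 | r₂ , o2 with larger-has-child j k i r₁ r₂ o1 o2 lt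
    ...   | c , rc , pc , ec , le = go (view c)
      where
      go : View c → ∃ λ c → ∃ λ rc → parent g c ≡ just j × σ' c ≡ active i rc × size g k ≤ size g c
      go (waits i' r₀ e e' _) with active-injective (trans (sym e) ec)
      ... | refl , refl = c , rc , pc , e' , le
      go (runs i' r₀ e e' _) with active-injective (trans (sym e) ec)
      ... | refl , refl = c , _ , pc , e' , le
      go (finishes i' r₀ e e' pcF _) with active-injective (trans (sym e) ec)
      ... | refl , refl with sizes-distinct k c i r₂ rc o2 ec (≤-antisym le (current-minimal (processed-current pcF) o2))
      ...   | refl = ⊥-elim (active≢done (trans (sym e2) e'))
      go (stays-pending e _) with trans (sym e) ec
      ... | ()
      go (stays-done _ _ e _) with trans (sym e) ec
      ... | ()

    inv' : Inv τ' σ' g'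
    inv' = record
      { pending-orphan = λ k e' → pending-orphan k (pending-before e')
      ; parent-admitted = λ c q pc e' → parent-admitted c q pc (pending-before e')
      ; active-inv = active-inv'
      ; done-inv = done-inv'
      ; sizes-distinct = λ j k i r r' e1 e2 xe → sizes-distinct j k i _ _ (proj₂ (active-before e1)) (proj₂ (active-before e2)) xe
      ; larger-has-child = larger-has-child'
      ; active-child-unique = λ c c' j i i' r r' pc pc' ec ec' → active-child-unique c c' j i i' _ _ pc pc' (proj₂ (active-before ec)) (proj₂ (active-before ec'))
      }

  advanceStep-preserves : ∀ {τ σ s'} g → Inv τ σ g → AdvanceStep (τ , σ) s' → ∃ λ g' → Inv (proj₁ s') (proj₂ s') g'
  advanceStep-preserves g inv (advance proc _ procH _ ev) = AdvancePreserves.g' inv proc procH ev , AdvancePreserves.inv' inv proc procH ev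

  step-preserves : ∀ {τ σ s'} g → Inv τ σ g → Step (τ , σ) s' → ∃ λ g' → Inv (proj₁ s') (proj₂ s') g'
  step-preserves g inv (inj₁ st) = admitStep-preserves g inv st
  step-preserves g inv (inj₂ st) = advanceStep-preserves g inv st

  reachable-invariant : ∀ {s} g → Inv (proj₁ s) (proj₂ s) g → ∀ {s'} → Star Step s s' → ∃ λ g' → Inv (proj₁ s') (proj₂ s') g'
  reachable-invariant g inv [] = g , inv
  reachable-invariant g inv (st ◅ rest) with step-preserves g inv st
  ... | g' , inv' = reachable-invariant g' inv' rest


theorem6 : (F : RealField) → (ε : RealField.R F) →
           RealField._<_ F (RealField.0# F) ε → RealField._≤_ F ε (RealField.1# F) →
           (m n : ℕ) (I : Instance F m n) → Slack F I ε →
           (τ₀ : RealField.R F) → (∀ j → RealField._≤_ F τ₀ (Instance.r I j)) →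
           (s : State F m n) →
           Star (Region.Step F I ε) (Region.initial F I ε τ₀) s →
           Region.Final F I ε s →
           Region.#admitted F I ε s ≤ℕ 2 *ℕ Region.#onTime F I ε s
theorem6 F ε 0<ε ε≤1 m n I _ τ₀ _ (τ , σ) run (_ , allIdle , _) =
  let g , inv = reachable-invariant ghost₀ (inv-initial τ₀) run
  in admitted≤2*onTime τ σ g inv (λ k i r σk≡active → allIdle i k (r , σk≡active))
  where open Invariant F ε (proj₁ 0<ε) ε≤1 I
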